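{- For any positive integers $a,b$, $$\frac{\vartheta_a\,\vartheta_b\,\vartheta_{a+b}}{\eta}=-\sum_{r,s\in\mathbb Z}\left(\frac s3\right)q^{r^2+rs+s^2/3}\,\zeta^{(a-b)r+as}.$$
   Context: $\eta(\tau)=q^{1/24}\prod_{n\ge1}(1-q^n)$, $\vartheta(\tau,z)=\sum_{r\in\mathbb Z}\left(\frac{ -4}{r}\right)q^{r^2/8}\zeta^{r/2}$, $q=e^{2\pi i\tau}$, $\zeta=e^{2\pi iz}$, $\vartheta_a(\tau,z)=\vartheta(\tau,az)$; $\left(\frac s3\right)$ is the Legendre symbol modulo $3$ and $\left(\frac{ -4}{r}\right)$ the Kronecker symbol (the nontrivial character modulo 4). -}

module Defs where

open import Data.Nat as ℕ using (ℕ; zero; suc; _∸_; _≤ᵇ_; _≡ᵇ_)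
open import Data.Integer using (ℤ; +_; _+_; _-_; _*_; -_; 0ℤ; 1ℤ; _%ℕ_)
open import Data.Integer.Properties using (_≟_)
open import Data.List using (List; map; foldr; upTo)
open import Data.Bool using (Bool; if_then_else_)
open import Relation.Nullary.Decidable using (⌊_⌋)

-- Conventions: x = q^(1/24), y = ζ^(1/2).  Every series below is a formal series
-- Σ c(N,m) x^N y^m with N ∈ ℕ, m ∈ ℤ, and is given by its coefficient function.

χ₋₄ : ℤ → ℤ
χ₋₄ r with r %ℕ 4
... | 1 = 1ℤ
... | 3 = - 1ℤ
... | _ = 0ℤ

leg3 : ℤ → ℤ
leg3 s with s %ℕ 3
... | 1 = 1ℤ
... | 2 = - 1ℤ
... | _ = 0ℤ

box : ℕ → List ℤ
box B = map (λ i → + i - + B) (upTo (suc (B ℕ.+ B)))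

sumL : List ℤ → ℤ
sumL = foldr _+_ 0ℤ

Σbox : ℕ → (ℤ → ℤ) → ℤ
Σbox B f = sumL (map f (box B))

Σupto : ℕ → (ℕ → ℤ) → ℤ
Σupto N f = sumL (map (λ k → f k) (upTo (suc N)))

when : ℤ → ℤ → ℤ → ℤ
when u v c = if ⌊ u ≟ v ⌋ then c else 0ℤ

sq : ℤ → ℤ
sq r = r * r

-- Coefficient of x^N y^m in ϑ_a ϑ_b ϑ_{a+b}, where
-- ϑ_c = Σ_r (-4/r) q^{r²/8} ζ^{c r/2} = Σ_r (-4/r) x^{3r²} y^{c r}.
-- Only triples with 3(r1²+r2²+r3²) = N contribute, so |ri| ≤ N.
thetaProdCoef : ℤ → ℤ → ℕ → ℤ → ℤ
thetaProdCoef a b N m =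
  Σbox N λ r₁ → Σbox N λ r₂ → Σbox N λ r₃ →
    when (+ 3 * (sq r₁ + sq r₂ + sq r₃)) (+ N)
      (when (a * r₁ + b * r₂ + (a + b) * r₃) m
        (χ₋₄ r₁ * χ₋₄ r₂ * χ₋₄ r₃))

-- Coefficient of x^k in the finite product ∏_{n=1}^{K} (1 - x^{24 n}) = ∏_{n=1}^K (1 - q^n).
prodCoef : ℕ → ℕ → ℤ
prodCoef zero k = if k ≡ᵇ 0 then 1ℤ else 0ℤ
prodCoef (suc K) k =
  prodCoef K k - (if (24 ℕ.* suc K) ≤ᵇ k then prodCoef K (k ∸ 24 ℕ.* suc K) else 0ℤ)

-- Coefficient of x^k in η = q^{1/24} ∏_{n≥1}(1 - q^n) = x ∏_{n ≥ 1} (1 - x^{24n}).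
-- For the coefficient of x^j in the infinite product, the factors with 24n > j are
-- irrelevant, so the truncation at n ≤ j is exact.
etaCoef : ℕ → ℤ
etaCoef zero = 0ℤ
etaCoef (suc j) = prodCoef j j

-- Coefficient of x^j y^m in
-- S = Σ_{r,s ∈ ℤ} (s/3) q^{r²+rs+s²/3} ζ^{(a-b)r+as}
--   = Σ_{r,s} (s/3) x^{8(3r²+3rs+s²)} y^{2((a-b)r+as)}.
-- Since 8(3r²+3rs+s²) ≥ 3(r²+s²), only |r|,|s| ≤ j contribute.
seriesCoef : ℤ → ℤ → ℕ → ℤ → ℤ
seriesCoef a b j m =
  Σbox j λ r → Σbox j λ s →
    when (+ 8 * (+ 3 * sq r + + 3 * (r * s) + sq s)) (+ j)
      (when (+ 2 * ((a - b) * r + a * s)) m (leg3 s))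

rhsCoef : ℤ → ℤ → ℕ → ℤ → ℤ
rhsCoef a b N m = - Σupto N (λ k → etaCoef k * seriesCoef a b (N ∸ k) m)

module Submission where

open import Defs
open import Data.Nat as ℕ using (ℕ; zero; suc; z≤n; s≤s; _∸_; _≤ᵇ_; _≤_)
import Data.Nat.Properties as ℕP
import Data.Nat.Tactic.RingSolver as ℕSolver
open import Data.Integer as ℤ using (ℤ; +_; -[1+_]; _+_; _-_; _*_; -_; 0ℤ; 1ℤ; ∣_∣; _%ℕ_; _/ℕ_; +≤+)
import Data.Integer.Properties as ℤP
open import Data.Integer.DivMod using (a≡a%ℕn+[a/ℕn]*n; n%ℕd<d)
open import Data.Integer.Tactic.RingSolver using (solve-∀)
open import Data.List using (List; []; _∷_; map; upTo; applyUpTo)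
import Data.List.Properties as LP
open import Data.Bool using (true; false; if_then_else_; T)
open import Data.Product using (_×_; _,_; proj₁; proj₂; Σ)
import Data.Product.Properties as PP
open import Data.Sum using (_⊎_; inj₁; inj₂)
open import Data.Empty using (⊥-elim)
open import Function using (_∘_)
open import Relation.Nullary using (¬_; Dec; yes; no)
open import Relation.Nullary.Decidable using (⌊_⌋)
open import Relation.Binary.Definitions using (DecidableEquality)
open import Relation.Binary.PropositionalEquality

-- Fix the coefficient of x^N y^m; every series is a finite sum over a box.
-- (1) Theta side: the substitution (r₁, r₂, r₃) = (2(s+r) - t, -2r - t, t) maps ℤ³
--     bijectively onto the triples of equal parity, which contain all triples with
--     χ₋₄(r₁)χ₋₄(r₂)χ₋₄(r₃) ≠ 0; it turns 3Σrᵢ² into (3t - 2s)² + 8Q(r,s), where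
--     Q = 3r² + 3rs + s², and the weight into χ₋₄(t)ε(s) with ε(s) = χ₋₄(1 + 2s).
--     So the coefficient is Σ_{r,s} [y-exponent = m] · θ-slice(s, N - 8Q).
-- (2) Eta side: Euler's pentagonal theorem, proved for finite products through
--     Shanks' telescoping identity, writes η = Σ_j χ₋₄(1+6j) x^{(1+6j)²}; the Cauchy
--     product with S then collapses to Σ_{r,s} [y-exponent = m] · -η-slice(s, N - 8Q).
-- (3) For each s the θ-slice is minus the η-slice: for s ≢ 0 (mod 3) by a
--     reindexing t = ±2j + const, for s ≡ 0 (mod 3) by an involution of t.

bracket : {A : Set} → DecidableEquality A → A → A → ℤ → ℤ
bracket _≟_ x c v = if ⌊ x ≟ c ⌋ then v else 0ℤ

module _ {A : Set} (_≟_ : DecidableEquality A) where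

  bracket-yes : ∀ {x c} v → x ≡ c → bracket _≟_ x c v ≡ v
  bracket-yes {x} {c} v x≡c with x ≟ c
  ... | yes _   = refl
  ... | no x≢c = ⊥-elim (x≢c x≡c)

  bracket-no : ∀ {x c} v → ¬ x ≡ c → bracket _≟_ x c v ≡ 0ℤ
  bracket-no {x} {c} v x≢c with x ≟ c
  ... | yes x≡c = ⊥-elim (x≢c x≡c)
  ... | no _    = refl

  bracket-zero : ∀ x c → bracket _≟_ x c 0ℤ ≡ 0ℤ
  bracket-zero x c with x ≟ c
  ... | yes _ = refl
  ... | no _  = refl

  bracket-nonzero : ∀ {x c v} → ¬ bracket _≟_ x c v ≡ 0ℤ → x ≡ c × ¬ v ≡ 0ℤ
  bracket-nonzero {x} {c} {v} nz with x ≟ c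
  ... | yes x≡c = x≡c , nz
  ... | no _    = ⊥-elim (nz refl)

when-yes : ∀ {u v} c → u ≡ v → when u v c ≡ c
when-yes = bracket-yes ℤP._≟_

when-no : ∀ {u v} c → ¬ u ≡ v → when u v c ≡ 0ℤ
when-no = bracket-no ℤP._≟_

when-zero : ∀ u v → when u v 0ℤ ≡ 0ℤ
when-zero = bracket-zero ℤP._≟_

when-nonzero : ∀ {u v c} → ¬ when u v c ≡ 0ℤ → u ≡ v × ¬ c ≡ 0ℤ
when-nonzero = bracket-nonzero ℤP._≟_

when-iff : ∀ {u v u' v'} c → (u ≡ v → u' ≡ v') → (u' ≡ v' → u ≡ v) → when u v c ≡ when u' v' c
when-iff {u} {v} c to from with u ℤP.≟ v
... | yes e = sym (when-yes c (to e))
... | no ne = sym (when-no c (λ e → ne (from e)))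

when-shift : ∀ X Y N c → when (X + Y) N c ≡ when X (N - Y) c
when-shift X Y N c = when-iff c (λ e → trans (l₁ X Y) (cong (_- Y) e)) (λ e → trans (cong (_+ Y) e) (l₂ N Y))
  where
  l₁ : ∀ X Y → X ≡ (X + Y) - Y
  l₁ = solve-∀
  l₂ : ∀ N Y → N - Y + Y ≡ N
  l₂ = solve-∀

when-comm : ∀ u v u' v' c → when u v (when u' v' c) ≡ when u' v' (when u v c)
when-comm u v u' v' c with u ℤP.≟ v | u' ℤP.≟ v'
... | yes _ | yes _ = refl
... | yes _ | no _  = refl
... | no _  | yes _ = refl
... | no _  | no _  = refl

when-*ˡ : ∀ u v c d → d * when u v c ≡ when u v (d * c)
when-*ˡ u v c d with u ℤP.≟ v
... | yes _ = refl
... | no _  = ℤP.*-zeroʳ d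

when-*ʳ : ∀ u v c d → when u v c * d ≡ when u v (c * d)
when-*ʳ u v c d with u ℤP.≟ v
... | yes _ = refl
... | no _  = refl

when-neg : ∀ u v c → - when u v c ≡ when u v (- c)
when-neg u v c with u ℤP.≟ v
... | yes _ = refl
... | no _  = refl

ΣL : {A : Set} → List A → (A → ℤ) → ℤ
ΣL L f = sumL (map f L)

ΣL-cong : {A : Set} (L : List A) {f g : A → ℤ} → (∀ x → f x ≡ g x) → ΣL L f ≡ ΣL L g
ΣL-cong []      f≗g = refl
ΣL-cong (x ∷ L) f≗g = cong₂ _+_ (f≗g x) (ΣL-cong L f≗g)

ΣL-0 : {A : Set} (L : List A) → ΣL L (λ _ → 0ℤ) ≡ 0ℤ
ΣL-0 []      = refl
ΣL-0 (x ∷ L) = trans (ℤP.+-identityˡ _) (ΣL-0 L)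

ΣL-vanish : {A : Set} (L : List A) (f : A → ℤ) → (∀ x → f x ≡ 0ℤ) → ΣL L f ≡ 0ℤ
ΣL-vanish L f f≗0 = trans (ΣL-cong L f≗0) (ΣL-0 L)

ΣL-+ : {A : Set} (L : List A) (f g : A → ℤ) → ΣL L (λ x → f x + g x) ≡ ΣL L f + ΣL L g
ΣL-+ []      f g = refl
ΣL-+ (x ∷ L) f g = trans (cong (_+_ (f x + g x)) (ΣL-+ L f g)) (interchange (f x) (g x) (ΣL L f) (ΣL L g))
  where
  interchange : ∀ a b c d → a + b + (c + d) ≡ a + c + (b + d)
  interchange = solve-∀

ΣL-*ˡ : {A : Set} (L : List A) (c : ℤ) (f : A → ℤ) → ΣL L (λ x → c * f x) ≡ c * ΣL L f
ΣL-*ˡ []      c f = sym (ℤP.*-zeroʳ c)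
ΣL-*ˡ (x ∷ L) c f = trans (cong (_+_ (c * f x)) (ΣL-*ˡ L c f)) (sym (ℤP.*-distribˡ-+ c (f x) (ΣL L f)))

ΣL-*ʳ : {A : Set} (L : List A) (c : ℤ) (f : A → ℤ) → ΣL L (λ x → f x * c) ≡ ΣL L f * c
ΣL-*ʳ L c f = trans (ΣL-cong L (λ x → ℤP.*-comm (f x) c)) (trans (ΣL-*ˡ L c f) (ℤP.*-comm c _))

ΣL-neg : {A : Set} (L : List A) (f : A → ℤ) → ΣL L (λ x → - f x) ≡ - ΣL L f
ΣL-neg L f = trans (ΣL-cong L (λ x → sym (ℤP.-1*i≡-i (f x)))) (trans (ΣL-*ˡ L (- 1ℤ) f) (ℤP.-1*i≡-i _))

ΣL-when : {A : Set} (L : List A) (u v : ℤ) (f : A → ℤ) → ΣL L (λ x → when u v (f x)) ≡ when u v (ΣL L f)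
ΣL-when L u v f with u ℤP.≟ v
... | yes _ = refl
... | no _  = ΣL-0 L

ΣL-swap : {A B : Set} (L : List A) (M : List B) (f : A → B → ℤ) →
  ΣL L (λ x → ΣL M (f x)) ≡ ΣL M (λ y → ΣL L (λ x → f x y))
ΣL-swap []      M f = sym (ΣL-0 M)
ΣL-swap (x ∷ L) M f =
  trans (cong (_+_ (ΣL M (f x))) (ΣL-swap L M f)) (sym (ΣL-+ M (f x) (λ y → ΣL L (λ x' → f x' y))))

sumN : ℕ → (ℕ → ℤ) → ℤ
sumN zero    f = 0ℤ
sumN (suc n) f = sumN n f + f n

sumN-cong : ∀ n {f g} → (∀ k → k ℕ.< n → f k ≡ g k) → sumN n f ≡ sumN n g
sumN-cong zero    f≗g = refl
sumN-cong (suc n) f≗g = cong₂ _+_ (sumN-cong n (λ k k<n → f≗g k (ℕP.m≤n⇒m≤1+n k<n))) (f≗g n ℕP.≤-refl)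

sumN-vanish : ∀ n (f : ℕ → ℤ) → (∀ k → f k ≡ 0ℤ) → sumN n f ≡ 0ℤ
sumN-vanish zero    f f≗0 = refl
sumN-vanish (suc n) f f≗0 = cong₂ _+_ (sumN-vanish n f f≗0) (f≗0 n)

sumN-+ : ∀ n (f g : ℕ → ℤ) → sumN n (λ k → f k + g k) ≡ sumN n f + sumN n g
sumN-+ zero    f g = refl
sumN-+ (suc n) f g = trans (cong (_+ (f n + g n)) (sumN-+ n f g)) (interchange (sumN n f) (sumN n g) (f n) (g n))
  where
  interchange : ∀ a b c d → a + b + (c + d) ≡ a + c + (b + d)
  interchange = solve-∀

sumN-telescope : ∀ n (g : ℕ → ℤ) → sumN n (λ k → g k - g (suc k)) ≡ g 0 - g n
sumN-telescope zero    g = sym (ℤP.+-inverseʳ (g 0))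
sumN-telescope (suc n) g = trans (cong (_+ (g n - g (suc n))) (sumN-telescope n g)) (cancel (g 0) (g n) (g (suc n)))
  where
  cancel : ∀ a b c → a - b + (b - c) ≡ a - c
  cancel = solve-∀

sumN-shift : ∀ n (f : ℕ → ℤ) → sumN (suc n) f ≡ f 0 + sumN n (f ∘ suc)
sumN-shift zero    f = trans (ℤP.+-identityˡ (f 0)) (sym (ℤP.+-identityʳ (f 0)))
sumN-shift (suc n) f = trans (cong (_+ f (suc n)) (sumN-shift n f)) (ℤP.+-assoc (f 0) _ _)

sumN-ΣL : {A : Set} (n : ℕ) (L : List A) (f : ℕ → A → ℤ) →
  sumN n (λ k → ΣL L (f k)) ≡ ΣL L (λ x → sumN n (λ k → f k x))
sumN-ΣL zero    L f = sym (ΣL-0 L)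
sumN-ΣL (suc n) L f = trans (cong (_+ ΣL L (f n)) (sumN-ΣL n L f)) (sym (ΣL-+ L (λ x → sumN n (λ k → f k x)) (f n)))

sumN-delta-out : ∀ n e (g : ℕ → ℤ) → n ≤ e → sumN n (λ k → when (+ e) (+ k) (g k)) ≡ 0ℤ
sumN-delta-out zero    e g _   = refl
sumN-delta-out (suc n) e g n<e =
  cong₂ _+_ (sumN-delta-out n e g (ℕP.<⇒≤ n<e)) (when-no (g n) (λ e≡n → ℕP.<-irrefl (sym (ℤP.+-injective e≡n)) n<e))

sumN-delta-in : ∀ n e (g : ℕ → ℤ) → e ℕ.< n → sumN n (λ k → when (+ e) (+ k) (g k)) ≡ g e
sumN-delta-in (suc n) e g e<1+n with ℕP.m≤n⇒m<n∨m≡n (ℕP.≤-pred e<1+n)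
... | inj₁ e<n =
  trans (cong₂ _+_ (sumN-delta-in n e g e<n) (when-no (g n) (λ e≡n → ℕP.<-irrefl (ℤP.+-injective e≡n) e<n)))
        (ℤP.+-identityʳ (g e))
... | inj₂ refl = trans (cong₂ _+_ (sumN-delta-out n e g ℕP.≤-refl) (when-yes (g e) refl)) (ℤP.+-identityˡ (g e))

sumL-applyUpTo : ∀ (f : ℕ → ℤ) n → sumL (applyUpTo f n) ≡ sumN n f
sumL-applyUpTo f zero    = refl
sumL-applyUpTo f (suc n) = trans (cong (_+_ (f 0)) (sumL-applyUpTo (f ∘ suc) n)) (sym (sumN-shift n f))

Σupto-sumN : ∀ N f → Σupto N f ≡ sumN (suc N) f
Σupto-sumN N f = trans (cong sumL (LP.map-upTo f (suc N))) (sumL-applyUpTo f (suc N))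

Σbox-sumN : ∀ B f → Σbox B f ≡ sumN (suc (B ℕ.+ B)) (λ i → f (+ i - + B))
Σbox-sumN B f =
  trans (cong sumL (trans (sym (LP.map-∘ {g = f} {f = λ i → + i - + B} (upTo n))) (LP.map-upTo (λ i → f (+ i - + B)) n)))
        (sumL-applyUpTo (λ i → f (+ i - + B)) n)
  where n = suc (B ℕ.+ B)

Σbox-cong : ∀ B {f g} → (∀ x → f x ≡ g x) → Σbox B f ≡ Σbox B g
Σbox-cong B = ΣL-cong (box B)

Σbox-zero : ∀ f → Σbox 0 f ≡ f 0ℤ
Σbox-zero f = ℤP.+-identityʳ (f 0ℤ)

Σbox-suc : ∀ B f → Σbox (suc B) f ≡ f -[1+ B ] + Σbox B f + f (+ suc B)
Σbox-suc B f = begin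
  Σbox (suc B) f                                      ≡⟨ Σbox-sumN (suc B) f ⟩
  sumN (suc (suc B ℕ.+ suc B)) h                      ≡⟨ cong (λ n → sumN (suc (suc n)) h) (ℕP.+-suc B B) ⟩
  sumN (suc (suc (B ℕ.+ B))) h + h (suc (suc (B ℕ.+ B))) ≡⟨ cong₂ _+_ (sumN-shift (suc (B ℕ.+ B)) h) (cong f right-end) ⟩
  h 0 + sumN (suc (B ℕ.+ B)) (h ∘ suc) + f (+ suc B)  ≡⟨ cong (λ s → h 0 + s + f (+ suc B)) inner ⟩
  f -[1+ B ] + Σbox B f + f (+ suc B)                 ∎
  where
  open ≡-Reasoning
  h : ℕ → ℤ
  h i = f (+ i - + suc B)
  shift-by-one : ∀ i → + suc i - + suc B ≡ + i - + B
  shift-by-one i = trans (cong₂ _-_ (ℤP.pos-+ 1 i) (ℤP.pos-+ 1 B)) (l (+ i) (+ B))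
    where
    l : ∀ a b → (+ 1 + a) - (+ 1 + b) ≡ a - b
    l = solve-∀
  right-end : + suc (suc (B ℕ.+ B)) - + suc B ≡ + suc B
  right-end = trans (cong (_- + suc B) (trans (cong (λ n → + suc n) (sym (ℕP.+-suc B B))) (ℤP.pos-+ (suc B) (suc B))))
                    (l (+ suc B))
    where
    l : ∀ a → (a + a) - a ≡ a
    l = solve-∀
  inner : sumN (suc (B ℕ.+ B)) (h ∘ suc) ≡ Σbox B f
  inner = trans (sumN-cong (suc (B ℕ.+ B)) (λ i _ → cong f (shift-by-one i))) (sym (Σbox-sumN B f))

Σbox-cong-in : ∀ B {f g} → (∀ x → ∣ x ∣ ≤ B → f x ≡ g x) → Σbox B f ≡ Σbox B g
Σbox-cong-in zero    {f} {g} f≗g = trans (Σbox-zero f) (trans (f≗g 0ℤ z≤n) (sym (Σbox-zero g)))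
Σbox-cong-in (suc B) {f} {g} f≗g = trans (Σbox-suc B f) (trans
  (cong₂ _+_ (cong₂ _+_ (f≗g -[1+ B ] ℕP.≤-refl) (Σbox-cong-in B (λ x x≤B → f≗g x (ℕP.m≤n⇒m≤1+n x≤B))))
             (f≗g (+ suc B) ℕP.≤-refl))
  (sym (Σbox-suc B g)))

Σbox-vanish : ∀ B f → (∀ x → ∣ x ∣ ≤ B → f x ≡ 0ℤ) → Σbox B f ≡ 0ℤ
Σbox-vanish B f f≗0 = trans (Σbox-cong-in B f≗0) (ΣL-0 (box B))

Σbox-widen : ∀ B B' f → B ≤ B' → (∀ x → B ℕ.< ∣ x ∣ → f x ≡ 0ℤ) → Σbox B' f ≡ Σbox B f
Σbox-widen B B' f B≤B' outside = go B' (ℕP.≤⇒≤′ B≤B')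
  where
  go : ∀ B' → B ℕ.≤′ B' → Σbox B' f ≡ Σbox B f
  go .B ℕ.≤′-refl = refl
  go (suc B'') (ℕ.≤′-step B≤B'') = begin
    Σbox (suc B'') f                              ≡⟨ Σbox-suc B'' f ⟩
    f -[1+ B'' ] + Σbox B'' f + f (+ suc B'')     ≡⟨ cong₂ _+_ (cong₂ _+_ (outside -[1+ B'' ] B<) (go B'' B≤B''))
                                                               (outside (+ suc B'') B<) ⟩
    0ℤ + Σbox B f + 0ℤ                            ≡⟨ trans (ℤP.+-identityʳ _) (ℤP.+-identityˡ _) ⟩
    Σbox B f                                      ∎
    where
    open ≡-Reasoning
    B< : B ℕ.< suc B''
    B< = s≤s (ℕP.≤′⇒≤ B≤B'')

Σbox-delta : ∀ B c v → ∣ c ∣ ≤ B → Σbox B (λ i → when i c v) ≡ v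
Σbox-delta zero c v c≤0 = trans (Σbox-zero (λ i → when i c v)) (when-yes v (sym (ℤP.∣i∣≡0⇒i≡0 (ℕP.n≤0⇒n≡0 c≤0))))
Σbox-delta (suc B) c v c≤1+B = trans (Σbox-suc B δc) (cases (ℕP.m≤n⇒m<n∨m≡n c≤1+B))
  where
  δc : ℤ → ℤ
  δc i = when i c v
  off : ∀ i → ¬ ∣ i ∣ ≡ ∣ c ∣ → δc i ≡ 0ℤ
  off i ne = when-no v (λ i≡c → ne (cong ∣_∣ i≡c))
  ends : ∀ c' → ∣ c' ∣ ≡ suc B → when -[1+ B ] c' v + 0ℤ + when (+ suc B) c' v ≡ v
  ends (+ .(suc B)) refl =
    trans (cong₂ _+_ (cong (_+ 0ℤ) (when-no { -[1+ B ]} {+ suc B} v (λ ()))) (when-yes {+ suc B} v refl))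
          (ℤP.+-identityˡ v)
  ends -[1+ .B ]    refl =
    trans (cong₂ _+_ (cong (_+ 0ℤ) (when-yes { -[1+ B ]} v refl)) (when-no {+ suc B} { -[1+ B ]} v (λ ())))
          (trans (ℤP.+-identityʳ _) (ℤP.+-identityʳ v))
  cases : ∣ c ∣ ℕ.< suc B ⊎ ∣ c ∣ ≡ suc B → δc -[1+ B ] + Σbox B δc + δc (+ suc B) ≡ v
  cases (inj₁ c<1+B) =
    trans (cong₂ _+_ (cong₂ _+_ (off -[1+ B ] (λ e → ℕP.<-irrefl (sym e) c<1+B)) (Σbox-delta B c v (ℕP.≤-pred c<1+B)))
                     (off (+ suc B) (λ e → ℕP.<-irrefl (sym e) c<1+B)))
          (trans (cong (_+ 0ℤ) (ℤP.+-identityˡ v)) (ℤP.+-identityʳ v))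
  cases (inj₂ c≡1+B) =
    trans (cong (λ s → δc -[1+ B ] + s + δc (+ suc B))
                (Σbox-vanish B δc (λ i i≤B → off i (λ e → ℕP.<-irrefl (trans e c≡1+B) (s≤s i≤B)))))
          (ends c c≡1+B)

-- A summation operator ∑ on A whose window (a predicate on A) contains the
-- support of everything it is applied to: it is all that reindexing a sum needs.
record Summation (A : Set) : Set₁ where
  field
    _≟_     : DecidableEquality A
    ∑       : (A → ℤ) → ℤ
    Window  : A → Set
    ∑-cong  : ∀ {f g} → (∀ x → f x ≡ g x) → ∑ f ≡ ∑ g
    ∑-0     : ∑ (λ _ → 0ℤ) ≡ 0ℤ
    ∑-delta : ∀ c v → Window c → ∑ (λ x → bracket _≟_ x c v) ≡ v

  ∑-delta′ : ∀ c v → (¬ v ≡ 0ℤ → Window c) → ∑ (λ x → bracket _≟_ x c v) ≡ v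
  ∑-delta′ c v inside with v ℤP.≟ 0ℤ
  ... | yes refl = trans (∑-cong (λ x → bracket-zero _≟_ x c)) ∑-0
  ... | no v≢0   = ∑-delta c v (inside v≢0)

nonzero-agree : ∀ {a b} → (¬ a ≡ 0ℤ → a ≡ b) → (¬ b ≡ 0ℤ → b ≡ a) → a ≡ b
nonzero-agree {a} {b} a→b b→a with a ℤP.≟ 0ℤ | b ℤP.≟ 0ℤ
... | yes refl | yes refl = refl
... | yes refl | no b≢0   = sym (b→a b≢0)
... | no a≢0   | _        = a→b a≢0

graph-agree : ∀ {A B : Set} (_≟A_ : DecidableEquality A) (_≟B_ : DecidableEquality B)
  (F : A → ℤ) (G : B → ℤ) (φ : A → B) (ψ : B → A) →
  (∀ x → ¬ F x ≡ 0ℤ → ψ (φ x) ≡ x × G (φ x) ≡ F x) →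
  ∀ x y → ¬ bracket _≟B_ y (φ x) (F x) ≡ 0ℤ → bracket _≟B_ y (φ x) (F x) ≡ bracket _≟A_ x (ψ y) (G y)
graph-agree _≟A_ _≟B_ F G φ ψ inverse x y nz with bracket-nonzero _≟B_ nz
... | refl , Fx≢0 =
  trans (bracket-yes _≟B_ (F x) refl)
        (sym (trans (bracket-yes _≟A_ (G (φ x)) (sym (proj₁ (inverse x Fx≢0)))) (proj₂ (inverse x Fx≢0))))

module Reindex {A B : Set} (SA : Summation A) (SB : Summation B)
  (swap : ∀ (f : A → B → ℤ) → Summation.∑ SA (λ x → Summation.∑ SB (f x))
                            ≡ Summation.∑ SB (λ y → Summation.∑ SA (λ x → f x y))) where

  private
    module SA = Summation SA
    module SB = Summation SB

  reindex : (F : A → ℤ) (G : B → ℤ) (φ : A → B) (ψ : B → A) →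
    (∀ x → ¬ F x ≡ 0ℤ → SA.Window x) → (∀ y → ¬ G y ≡ 0ℤ → SB.Window y) →
    (∀ x → ¬ F x ≡ 0ℤ → ψ (φ x) ≡ x × G (φ x) ≡ F x) →
    (∀ y → ¬ G y ≡ 0ℤ → φ (ψ y) ≡ y × F (ψ y) ≡ G y) →
    SA.∑ F ≡ SB.∑ G
  reindex F G φ ψ suppF suppG φ-inverse ψ-inverse = begin
    SA.∑ F                                                      ≡⟨ SA.∑-cong (λ x → sym (SB.∑-delta′ (φ x) (F x) (windowB x))) ⟩
    SA.∑ (λ x → SB.∑ (λ y → bracket SB._≟_ y (φ x) (F x)))     ≡⟨ swap _ ⟩
    SB.∑ (λ y → SA.∑ (λ x → bracket SB._≟_ y (φ x) (F x)))     ≡⟨ SB.∑-cong (λ y → SA.∑-cong (λ x → symmetric x y)) ⟩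
    SB.∑ (λ y → SA.∑ (λ x → bracket SA._≟_ x (ψ y) (G y)))     ≡⟨ SB.∑-cong (λ y → SA.∑-delta′ (ψ y) (G y) (windowA y)) ⟩
    SB.∑ G                                                      ∎
    where
    open ≡-Reasoning
    windowB : ∀ x → ¬ F x ≡ 0ℤ → SB.Window (φ x)
    windowB x Fx≢0 = suppG (φ x) (λ e → Fx≢0 (trans (sym (proj₂ (φ-inverse x Fx≢0))) e))
    windowA : ∀ y → ¬ G y ≡ 0ℤ → SA.Window (ψ y)
    windowA y Gy≢0 = suppF (ψ y) (λ e → Gy≢0 (trans (sym (proj₂ (ψ-inverse y Gy≢0))) e))
    symmetric : ∀ x y → bracket SB._≟_ y (φ x) (F x) ≡ bracket SA._≟_ x (ψ y) (G y)
    symmetric x y = nonzero-agree (graph-agree SA._≟_ SB._≟_ F G φ ψ φ-inverse x y)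
                                  (graph-agree SB._≟_ SA._≟_ G F ψ φ ψ-inverse y x)

module Involution {A : Set} (S : Summation A)
  (swap : ∀ (f : A → A → ℤ) → Summation.∑ S (λ x → Summation.∑ S (f x))
                            ≡ Summation.∑ S (λ y → Summation.∑ S (λ x → f x y)))
  (∑-neg : ∀ f → Summation.∑ S (λ x → - f x) ≡ - Summation.∑ S f) where

  open Summation S
  open Reindex S S swap

  vanish-by-involution : (F : A → ℤ) (ι : A → A) → (∀ x → ¬ F x ≡ 0ℤ → Window x) →
    (∀ x → ¬ F x ≡ 0ℤ → ι (ι x) ≡ x × F (ι x) ≡ - F x) → ∑ F ≡ 0ℤ
  vanish-by-involution F ι suppF antisym = self-negative (trans (reindex F (λ x → - F x) ι ι suppF suppG forward backward) (∑-neg F))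
    where
    nz : ∀ x → ¬ - F x ≡ 0ℤ → ¬ F x ≡ 0ℤ
    nz x n e = n (cong -_ e)
    suppG : ∀ x → ¬ - F x ≡ 0ℤ → Window x
    suppG x n = suppF x (nz x n)
    forward : ∀ x → ¬ F x ≡ 0ℤ → ι (ι x) ≡ x × - F (ι x) ≡ F x
    forward x n = proj₁ (antisym x n) , trans (cong -_ (proj₂ (antisym x n))) (ℤP.neg-involutive (F x))
    backward : ∀ x → ¬ - F x ≡ 0ℤ → ι (ι x) ≡ x × F (ι x) ≡ - F x
    backward x n = antisym x (nz x n)
    self-negative : ∀ {z} → z ≡ - z → z ≡ 0ℤ
    self-negative {z} e = ℤP.*-cancelˡ-≡ (+ 2) z 0ℤ (trans (double z) (trans (cong (_+_ z) e) (ℤP.+-inverseʳ z)))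
      where
      double : ∀ z → + 2 * z ≡ z + z
      double = solve-∀

boxSum : ℕ → Summation ℤ
boxSum B = record
  { _≟_ = ℤP._≟_ ; ∑ = Σbox B ; Window = λ x → ∣ x ∣ ≤ B
  ; ∑-cong = Σbox-cong B ; ∑-0 = ΣL-0 (box B) ; ∑-delta = Σbox-delta B }

Triple : Set
Triple = ℤ × ℤ × ℤ

_≟³_ : DecidableEquality Triple
_≟³_ = PP.≡-dec ℤP._≟_ (PP.≡-dec ℤP._≟_ ℤP._≟_)

Σ³ : ℕ → (Triple → ℤ) → ℤ
Σ³ B F = Σbox B (λ a → Σbox B (λ b → Σbox B (λ c → F (a , b , c))))

Σ³-cong : ∀ B {f g : Triple → ℤ} → (∀ x → f x ≡ g x) → Σ³ B f ≡ Σ³ B g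
Σ³-cong B f≗g = Σbox-cong B (λ a → Σbox-cong B (λ b → Σbox-cong B (λ c → f≗g (a , b , c))))

bracket³ : ∀ a b c a' b' c' v →
  bracket _≟³_ (a , b , c) (a' , b' , c') v ≡ when a a' (when b b' (when c c' v))
bracket³ a b c a' b' c' v with (a , b , c) ≟³ (a' , b' , c')
... | yes refl = sym (trans (when-yes {a} _ refl) (trans (when-yes {b} _ refl) (when-yes {c} _ refl)))
... | no ne with a ℤP.≟ a' | b ℤP.≟ b' | c ℤP.≟ c'
...   | yes refl | yes refl | yes refl = ⊥-elim (ne refl)
...   | no _     | _        | _        = refl
...   | yes _    | no _     | _        = refl
...   | yes _    | yes _    | no _     = refl

InCube : ℕ → Triple → Set
InCube B (a , b , c) = ∣ a ∣ ≤ B × ∣ b ∣ ≤ B × ∣ c ∣ ≤ B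

Σ³-delta : ∀ B x v → InCube B x → Σ³ B (λ y → bracket _≟³_ y x v) ≡ v
Σ³-delta B (a' , b' , c') v (a'≤B , b'≤B , c'≤B) = begin
  Σ³ B (λ y → bracket _≟³_ y (a' , b' , c') v)
    ≡⟨ Σ³-cong B (λ { (a , b , c) → bracket³ a b c a' b' c' v }) ⟩
  Σbox B (λ a → Σbox B (λ b → Σbox B (λ c → when a a' (when b b' (when c c' v)))))
    ≡⟨ Σbox-cong B (λ a → trans (Σbox-cong B (λ b → ΣL-when (box B) a a' _)) (ΣL-when (box B) a a' _)) ⟩
  Σbox B (λ a → when a a' (Σbox B (λ b → Σbox B (λ c → when b b' (when c c' v)))))
    ≡⟨ Σbox-cong B (λ a → cong (when a a') (Σbox-cong B (λ b →
         trans (ΣL-when (box B) b b' _) (cong (when b b') (Σbox-delta B c' v c'≤B))))) ⟩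
  Σbox B (λ a → when a a' (Σbox B (λ b → when b b' v)))
    ≡⟨ Σbox-cong B (λ a → cong (when a a') (Σbox-delta B b' v b'≤B)) ⟩
  Σbox B (λ a → when a a' v)
    ≡⟨ Σbox-delta B a' v a'≤B ⟩
  v ∎
  where open ≡-Reasoning

Σbox-Σ³ : ∀ B (f : ℤ → Triple → ℤ) → Σbox B (λ z → Σ³ B (f z)) ≡ Σ³ B (λ y → Σbox B (λ z → f z y))
Σbox-Σ³ B f =
  trans (ΣL-swap (box B) (box B) (λ z a → Σbox B (λ b → Σbox B (λ c → f z (a , b , c)))))
        (Σbox-cong B (λ a → trans (ΣL-swap (box B) (box B) (λ z b → Σbox B (λ c → f z (a , b , c))))
                                  (Σbox-cong B (λ b → ΣL-swap (box B) (box B) (λ z c → f z (a , b , c))))))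

Σ³-swap : ∀ B (f : Triple → Triple → ℤ) → Σ³ B (λ x → Σ³ B (f x)) ≡ Σ³ B (λ y → Σ³ B (λ x → f x y))
Σ³-swap B f =
  trans (Σbox-cong B (λ a → trans (Σbox-cong B (λ b → Σbox-Σ³ B (λ c → f (a , b , c))))
                                  (Σbox-Σ³ B (λ b y → Σbox B (λ c → f (a , b , c) y)))))
        (Σbox-Σ³ B (λ a y → Σbox B (λ b → Σbox B (λ c → f (a , b , c) y))))

cubeSum : ℕ → Summation Triple
cubeSum B = record
  { _≟_ = _≟³_ ; ∑ = Σ³ B ; Window = InCube B
  ; ∑-cong = Σ³-cong B ; ∑-0 = Σbox-vanish B _ (λ a _ → Σbox-vanish B _ (λ b _ → ΣL-0 (box B))) ; ∑-delta = Σ³-delta B }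

divmod-unique : ∀ d .{{_ : ℕ.NonZero d}} {ρ ρ' q q'} → ρ ℕ.< d → ρ' ℕ.< d →
  + ρ + q * + d ≡ + ρ' + q' * + d → ρ ≡ ρ' × q ≡ q'
divmod-unique d {ρ} {ρ'} {q} {q'} ρ<d ρ'<d e = ρ≡ρ' , q≡q'
  where
  difference : + ρ - + ρ' ≡ (q' - q) * + d
  difference = trans (l₁ (+ ρ) (+ ρ') q (+ d)) (trans (cong (λ z → z - + ρ' - q * + d) e) (l₂ (+ ρ') q q' (+ d)))
    where
    l₁ : ∀ a b x c → a - b ≡ (a + x * c) - b - x * c
    l₁ = solve-∀
    l₂ : ∀ b x y c → (b + y * c) - b - x * c ≡ (y - x) * c
    l₂ = solve-∀
  remainders-close : ∣ + ρ - + ρ' ∣ ℕ.< d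
  remainders-close = subst (ℕ._< d) (cong ∣_∣ (sym (ℤP.m-n≡m⊖n ρ ρ')))
                           (ℕP.≤-<-trans (ℤP.∣m⊝n∣≤m⊔n ρ ρ') (ℕP.⊔-pres-<m ρ<d ρ'<d))
  below-one : ∀ k → k ℕ.* d ℕ.< d → k ≡ 0
  below-one zero    _  = refl
  below-one (suc k) lt = ⊥-elim (ℕP.<-irrefl refl (ℕP.≤-<-trans (ℕP.m≤m+n d (k ℕ.* d)) lt))
  q'-q≡0 : q' - q ≡ 0ℤ
  q'-q≡0 = ℤP.∣i∣≡0⇒i≡0 (below-one ∣ q' - q ∣
             (subst (ℕ._< d) (trans (cong ∣_∣ difference) (ℤP.∣i*j∣≡∣i∣*∣j∣ (q' - q) (+ d))) remainders-close))
  q≡q' : q ≡ q'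
  q≡q' = sym (ℤP.i-j≡0⇒i≡j q' q q'-q≡0)
  ρ≡ρ' : ρ ≡ ρ'
  ρ≡ρ' = ℤP.+-injective (ℤP.i-j≡0⇒i≡j (+ ρ) (+ ρ') (trans difference (cong (_* + d) q'-q≡0)))

mod-of : ∀ d .{{_ : ℕ.NonZero d}} ρ q → ρ ℕ.< d → (+ ρ + q * + d) %ℕ d ≡ ρ
mod-of d ρ q ρ<d = sym (proj₁ (divmod-unique d {ρ} {x %ℕ d} {q} {x /ℕ d} ρ<d (n%ℕd<d x d) (a≡a%ℕn+[a/ℕn]*n x d)))
  where x = + ρ + q * + d

div-of : ∀ d .{{_ : ℕ.NonZero d}} ρ q → ρ ℕ.< d → (+ ρ + q * + d) /ℕ d ≡ q
div-of d ρ q ρ<d = sym (proj₂ (divmod-unique d {ρ} {x %ℕ d} {q} {x /ℕ d} ρ<d (n%ℕd<d x d) (a≡a%ℕn+[a/ℕn]*n x d)))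
  where x = + ρ + q * + d

mod-periodic : ∀ d .{{_ : ℕ.NonZero d}} x z → (x + z * + d) %ℕ d ≡ x %ℕ d
mod-periodic d x z = trans (cong (_%ℕ d) regroup) (mod-of d (x %ℕ d) (x /ℕ d + z) (n%ℕd<d x d))
  where
  regroup : x + z * + d ≡ + (x %ℕ d) + (x /ℕ d + z) * + d
  regroup = trans (cong (_+ z * + d) (a≡a%ℕn+[a/ℕn]*n x d)) (l (+ (x %ℕ d)) (x /ℕ d) z (+ d))
    where
    l : ∀ a b z c → a + b * c + z * c ≡ a + (b + z) * c
    l = solve-∀

-- Every integer is a residue plus a multiple of d; all facts about χ₋₄ and
-- (·/3) below reduce, via periodicity, to a finite check on residues.
residue : ∀ d .{{_ : ℕ.NonZero d}} x → Σ ℕ λ ρ → Σ ℤ λ q → ρ ℕ.< d × x ≡ + ρ + q * + d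
residue d x = x %ℕ d , x /ℕ d , n%ℕd<d x d , a≡a%ℕn+[a/ℕn]*n x d

χ₋₄-table : ℕ → ℤ
χ₋₄-table 1 = 1ℤ
χ₋₄-table 3 = - 1ℤ
χ₋₄-table _ = 0ℤ

χ₋₄-via-table : ∀ x → χ₋₄ x ≡ χ₋₄-table (x %ℕ 4)
χ₋₄-via-table x with x %ℕ 4
... | 0 = refl
... | 1 = refl
... | 2 = refl
... | 3 = refl
... | suc (suc (suc (suc _))) = refl

leg3-table : ℕ → ℤ
leg3-table 1 = 1ℤ
leg3-table 2 = - 1ℤ
leg3-table _ = 0ℤ

leg3-via-table : ∀ x → leg3 x ≡ leg3-table (x %ℕ 3)
leg3-via-table x with x %ℕ 3
... | 0 = refl
... | 1 = refl
... | 2 = refl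
... | suc (suc (suc _)) = refl

χ₋₄-periodic : ∀ x z → χ₋₄ (x + z * + 4) ≡ χ₋₄ x
χ₋₄-periodic x z = trans (χ₋₄-via-table (x + z * + 4)) (trans (cong χ₋₄-table (mod-periodic 4 x z)) (sym (χ₋₄-via-table x)))

leg3-periodic : ∀ x z → leg3 (x + z * + 3) ≡ leg3 x
leg3-periodic x z = trans (leg3-via-table (x + z * + 3)) (trans (cong leg3-table (mod-periodic 3 x z)) (sym (leg3-via-table x)))

χ₋₄-odd : ∀ x → χ₋₄ (- x) ≡ - χ₋₄ x
χ₋₄-odd x with residue 4 x
... | ρ , q , ρ<4 , refl =
  trans (cong χ₋₄ (l (+ ρ) q)) (trans (χ₋₄-periodic (- + ρ) (- q)) (trans (table ρ ρ<4) (cong -_ (sym (χ₋₄-periodic (+ ρ) q)))))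
  where
  l : ∀ a q → - (a + q * + 4) ≡ - a + (- q) * + 4
  l = solve-∀
  table : ∀ ρ → ρ ℕ.< 4 → χ₋₄ (- + ρ) ≡ - χ₋₄ (+ ρ)
  table 0 _ = refl
  table 1 _ = refl
  table 2 _ = refl
  table 3 _ = refl
  table (suc (suc (suc (suc _)))) (s≤s (s≤s (s≤s (s≤s ()))))

χ₋₄-cube : ∀ x → χ₋₄ x * χ₋₄ x * χ₋₄ x ≡ χ₋₄ x
χ₋₄-cube x with residue 4 x
... | ρ , q , ρ<4 , refl = trans (cong (λ z → z * z * z) (χ₋₄-periodic (+ ρ) q)) (trans (table ρ ρ<4) (sym (χ₋₄-periodic (+ ρ) q)))
  where
  table : ∀ ρ → ρ ℕ.< 4 → χ₋₄ (+ ρ) * χ₋₄ (+ ρ) * χ₋₄ (+ ρ) ≡ χ₋₄ (+ ρ)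
  table 0 _ = refl
  table 1 _ = refl
  table 2 _ = refl
  table 3 _ = refl
  table (suc (suc (suc (suc _)))) (s≤s (s≤s (s≤s (s≤s ()))))

odd-witness : ∀ r → ¬ χ₋₄ r ≡ 0ℤ → Σ ℤ λ u → r ≡ + 1 + + 2 * u
odd-witness r χr≢0 with residue 4 r
... | ρ , q , ρ<4 , refl = table ρ ρ<4 (λ e → χr≢0 (trans (χ₋₄-periodic (+ ρ) q) e))
  where
  table : ∀ ρ → ρ ℕ.< 4 → ¬ χ₋₄ (+ ρ) ≡ 0ℤ → Σ ℤ λ u → + ρ + q * + 4 ≡ + 1 + + 2 * u
  table 0 _ n = ⊥-elim (n refl)
  table 1 _ _ = q * + 2 , l q
    where
    l : ∀ q → + 1 + q * + 4 ≡ + 1 + + 2 * (q * + 2)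
    l = solve-∀
  table 2 _ n = ⊥-elim (n refl)
  table (suc (suc (suc (suc _)))) (s≤s (s≤s (s≤s (s≤s ())))) _
  table 3 _ _ = + 1 + q * + 2 , l q
    where
    l : ∀ q → + 3 + q * + 4 ≡ + 1 + + 2 * (+ 1 + q * + 2)
    l = solve-∀

-- On odd integers χ₋₄(1 + 2y) = ε(y) is the sign (-1)^y.
ε : ℤ → ℤ
ε y = χ₋₄ (+ 1 + + 2 * y)

χ₋₄-shift : ∀ x y → χ₋₄ (x + + 2 * y) ≡ χ₋₄ x * ε y
χ₋₄-shift x y with residue 4 x | residue 2 y
... | ρ , q , ρ<4 , refl | σ , p , σ<2 , refl =
  trans (cong χ₋₄ (l₁ (+ ρ) q (+ σ) p)) (trans (χ₋₄-periodic (+ ρ + + 2 * + σ) (q + p))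
    (trans (table ρ σ ρ<4 σ<2)
      (sym (cong₂ _*_ (χ₋₄-periodic (+ ρ) q) (trans (cong χ₋₄ (l₂ (+ σ) p)) (χ₋₄-periodic (+ 1 + + 2 * + σ) p))))))
  where
  l₁ : ∀ a q b p → a + q * + 4 + + 2 * (b + p * + 2) ≡ (a + + 2 * b) + (q + p) * + 4
  l₁ = solve-∀
  l₂ : ∀ b p → + 1 + + 2 * (b + p * + 2) ≡ (+ 1 + + 2 * b) + p * + 4
  l₂ = solve-∀
  table : ∀ ρ σ → ρ ℕ.< 4 → σ ℕ.< 2 → χ₋₄ (+ ρ + + 2 * + σ) ≡ χ₋₄ (+ ρ) * ε (+ σ)
  table 0 0 _ _ = refl
  table 0 1 _ _ = refl
  table 1 0 _ _ = refl
  table 1 1 _ _ = refl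
  table 2 0 _ _ = refl
  table 2 1 _ _ = refl
  table 3 0 _ _ = refl
  table 3 1 _ _ = refl
  table (suc (suc (suc (suc _)))) _ (s≤s (s≤s (s≤s (s≤s ())))) _
  table _ (suc (suc _)) _ (s≤s (s≤s ()))

ε-square : ∀ y → ε y * ε y ≡ 1ℤ
ε-square y with residue 2 y
... | σ , p , σ<2 , refl =
  trans (cong (λ z → z * z) (trans (cong χ₋₄ (l (+ σ) p)) (χ₋₄-periodic (+ 1 + + 2 * + σ) p))) (table σ σ<2)
  where
  l : ∀ b p → + 1 + + 2 * (b + p * + 2) ≡ (+ 1 + + 2 * b) + p * + 4
  l = solve-∀
  table : ∀ σ → σ ℕ.< 2 → ε (+ σ) * ε (+ σ) ≡ 1ℤ
  table 0 _ = refl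
  table 1 _ = refl
  table (suc (suc _)) (s≤s (s≤s ()))

ε-hom : ∀ y z → ε (y + z) ≡ ε y * ε z
ε-hom y z = trans (cong χ₋₄ (l y z)) (χ₋₄-shift (+ 1 + + 2 * y) z)
  where
  l : ∀ y z → + 1 + + 2 * (y + z) ≡ (+ 1 + + 2 * y) + + 2 * z
  l = solve-∀

ε-cancel : ∀ y c → c * ε y * ε y ≡ c
ε-cancel y c = trans (ℤP.*-assoc c (ε y) (ε y)) (trans (cong (c *_) (ε-square y)) (ℤP.*-identityʳ c))

ε-even : ∀ y → ε (- y) ≡ ε y
ε-even y = begin
  ε (- y)                     ≡⟨ sym (ε-cancel y (ε (- y))) ⟩
  ε (- y) * ε y * ε y         ≡⟨ cong (_* ε y) (sym (ε-hom (- y) y)) ⟩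
  ε (- y + y) * ε y           ≡⟨ cong (λ z → ε z * ε y) (ℤP.+-inverseˡ y) ⟩
  ε 0ℤ * ε y                  ≡⟨ ℤP.*-identityˡ (ε y) ⟩
  ε y                         ∎
  where open ≡-Reasoning

ε-triple : ∀ y → ε (+ 3 * y) ≡ ε y
ε-triple y = begin
  ε (+ 3 * y)                 ≡⟨ cong ε (l y) ⟩
  ε (y + y + y)               ≡⟨ trans (ε-hom (y + y) y) (cong (_* ε y) (ε-hom y y)) ⟩
  ε y * ε y * ε y             ≡⟨ ε-cancel y (ε y) ⟩
  ε y                         ∎
  where
  open ≡-Reasoning
  l : ∀ y → + 3 * y ≡ y + y + y
  l = solve-∀

-- On the progression 1 + 6ℤ, which indexes the pentagonal numbers, χ₋₄ is ε.
χ₋₄-pentagonal : ∀ j → χ₋₄ (+ 1 + + 6 * j) ≡ ε j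
χ₋₄-pentagonal j = trans (cong χ₋₄ (l j)) (ε-triple j)
  where
  l : ∀ j → + 1 + + 6 * j ≡ + 1 + + 2 * (+ 3 * j)
  l = solve-∀

sq-abs : ∀ y → sq y ≡ + (∣ y ∣ ℕ.* ∣ y ∣)
sq-abs (+ n)    = sym (ℤP.pos-* n n)
sq-abs -[1+ n ] = refl

sq-nonneg : ∀ x → 0ℤ ℤ.≤ sq x
sq-nonneg x = subst (0ℤ ℤ.≤_) (sym (sq-abs x)) (+≤+ z≤n)

nonneg-+ : ∀ {a b} → 0ℤ ℤ.≤ a → 0ℤ ℤ.≤ b → 0ℤ ℤ.≤ a + b
nonneg-+ = ℤP.+-mono-≤

nonneg-scale : ∀ c {a} → 0ℤ ℤ.≤ a → 0ℤ ℤ.≤ + c * a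
nonneg-scale c {+ n} _ = subst (0ℤ ℤ.≤_) (ℤP.pos-* c n) (+≤+ z≤n)

n≤n*n : ∀ n → n ≤ n ℕ.* n
n≤n*n zero    = z≤n
n≤n*n (suc n) = ℕP.m≤m*n (suc n) (suc n)

square-bound : ∀ x W N → sq x + W ≡ + N → 0ℤ ℤ.≤ W → ∣ x ∣ ≤ N
square-bound x (+ w) N e _ =
  ℕP.≤-trans (n≤n*n ∣ x ∣) (ℕP.≤-trans (ℕP.m≤m+n (∣ x ∣ ℕ.* ∣ x ∣) w)
    (ℕP.≤-reflexive (ℤP.+-injective (trans (ℤP.pos-+ (∣ x ∣ ℕ.* ∣ x ∣) w) (trans (cong (_+ + w) (sym (sq-abs x))) e)))))

square-bound-≤ : ∀ y K N → sq y ≡ K → K ℤ.≤ + N → ∣ y ∣ ≤ N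
square-bound-≤ y K N e K≤N = square-bound y (+ N - K) N (trans (cong (_+ (+ N - K)) e) (l K (+ N))) (ℤP.i≤j⇒0≤j-i K≤N)
  where
  l : ∀ K N → K + (N - K) ≡ N
  l = solve-∀

-- The formal power series in x used below have integer exponents; a series is
-- given by its coefficient function ℤ → ℤ, and δ is the series 1.
δ : ℤ → ℤ
δ z = when z 0ℤ 1ℤ

-- Coefficients of the finite product ∏_{a ≤ i < a+L} (1 - x^{24 i}) = ∏ (1 - q^i),
-- computed by splitting off the first factor.
prodFrom : ℕ → ℕ → ℤ → ℤ
prodFrom a zero    z = δ z
prodFrom a (suc L) z = prodFrom (suc a) L z - prodFrom (suc a) L (z - + (24 ℕ.* a))

sub-+ : ∀ z a b → z - + (a ℕ.+ b) ≡ z - + a - + b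
sub-+ z a b = trans (cong (_-_ z) (ℤP.pos-+ a b)) (l z (+ a) (+ b))
  where
  l : ∀ z x y → z - (x + y) ≡ z - x - y
  l = solve-∀

prodFrom-last : ∀ a L z → prodFrom a (suc L) z ≡ prodFrom a L z - prodFrom a L (z - + (24 ℕ.* (a ℕ.+ L)))
prodFrom-last a zero z = cong (λ w → δ z - δ (z - + (24 ℕ.* w))) (sym (ℕP.+-identityʳ a))
prodFrom-last a (suc L) z =
  trans (cong₂ _-_ (prodFrom-last (suc a) L z) (prodFrom-last (suc a) L (z - + (24 ℕ.* a))))
    (trans (cong₂ (λ u v → (P z - P (z - + (24 ℕ.* u))) - (P (z - + (24 ℕ.* a)) - P v)) (sym (ℕP.+-suc a L)) commute)
           (l (P z) (P (z - + (24 ℕ.* (a ℕ.+ suc L)))) (P (z - + (24 ℕ.* a)))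
              (P (z - + (24 ℕ.* (a ℕ.+ suc L)) - + (24 ℕ.* a)))))
  where
  P = prodFrom (suc a) L
  l : ∀ p q r s → (p - q) - (r - s) ≡ (p - r) - (q - s)
  l = solve-∀
  commute : z - + (24 ℕ.* a) - + (24 ℕ.* (suc a ℕ.+ L)) ≡ z - + (24 ℕ.* (a ℕ.+ suc L)) - + (24 ℕ.* a)
  commute = trans (cong (λ w → z - + (24 ℕ.* a) - + (24 ℕ.* w)) (sym (ℕP.+-suc a L))) (l′ z (+ (24 ℕ.* a)) (+ (24 ℕ.* (a ℕ.+ suc L))))
    where
    l′ : ∀ z x y → z - x - y ≡ z - y - x
    l′ = solve-∀

negative-sub : ∀ k m → Σ ℕ λ k' → -[1+ k ] - + m ≡ -[1+ k' ]
negative-sub k zero    = k , refl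
negative-sub k (suc m) = suc (k ℕ.+ m) , refl

prodFrom-negative : ∀ a L k → prodFrom a L -[1+ k ] ≡ 0ℤ
prodFrom-negative a zero    k = refl
prodFrom-negative a (suc L) k with negative-sub k (24 ℕ.* a)
... | k' , e = cong₂ _-_ (prodFrom-negative (suc a) L k) (trans (cong (prodFrom (suc a) L) e) (prodFrom-negative (suc a) L k'))

sub-below : ∀ d E → d ℕ.< E → + d - + E ≡ -[1+ (E ∸ suc d) ]
sub-below d E d<E = trans (ℤP.m-n≡m⊖n d E) (trans (ℤP.⊖-< d<E) (cong (λ w → - + w) (ℕP.+-∸-assoc 1 d<E)))

sub-above : ∀ d E → E ≤ d → + d - + E ≡ + (d ∸ E)
sub-above d E E≤d = trans (ℤP.m-n≡m⊖n d E) (ℤP.⊖-≥ E≤d)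

prodCoef-prodFrom : ∀ n d → prodCoef n d ≡ prodFrom 1 n (+ d)
prodCoef-prodFrom zero zero    = refl
prodCoef-prodFrom zero (suc d) = refl
prodCoef-prodFrom (suc n) d =
  trans (cong₂ _-_ (prodCoef-prodFrom n d) lastFactor) (sym (prodFrom-last 1 n (+ d)))
  where
  E = 24 ℕ.* suc n
  lastFactor : (if E ≤ᵇ d then prodCoef n (d ∸ E) else 0ℤ) ≡ prodFrom 1 n (+ d - + E)
  lastFactor with E ≤ᵇ d in eq
  ... | true  = trans (prodCoef-prodFrom n (d ∸ E)) (cong (prodFrom 1 n) (sym (sub-above d E (ℕP.≤ᵇ⇒≤ E d (subst T (sym eq) _)))))
  ... | false = sym (trans (cong (prodFrom 1 n) (sub-below d E (ℕP.≰⇒> (λ E≤d → subst T eq (ℕP.≤⇒≤ᵇ E≤d)))))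
                           (prodFrom-negative 1 n _))

-- With t(k) = k(k+1)/2 and the terms
--   S(n,k) = (-1)^k x^{24(nk + t(k))} ∏_{k < i ≤ n} (1 - x^{24 i}),
-- the sum Σ_{k ≤ n} S(n,k) equals the truncated pentagonal series
-- Σ_{|j| ≤ n} (-1)^j x^{24 j(3j+1)/2}, by a telescoping induction on n.
-- t(k) = k(k+1)/2, (-1)^k, and the exponent nk + t(k) of S(n,k) over 24.
tri : ℕ → ℕ
tri zero    = 0
tri (suc k) = tri k ℕ.+ suc k

sgN : ℕ → ℤ
sgN zero    = 1ℤ
sgN (suc k) = - sgN k

shanksExp : ℕ → ℕ → ℕ
shanksExp n k = n ℕ.* k ℕ.+ tri k

shanksTerm : ℕ → ℕ → ℤ → ℤ
shanksTerm n k z = sgN k * prodFrom (suc k) (n ∸ k) (z - + (24 ℕ.* shanksExp n k))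

shanksCorrection : ℕ → ℕ → ℤ → ℤ
shanksCorrection n k z = - sgN k * prodFrom k (suc n ∸ k) (z - + (24 ℕ.* shanksExp n k))

shanks-step : ∀ n k → k ≤ n → ∀ z →
  shanksTerm (suc n) k z ≡ shanksTerm n k z + (shanksCorrection n k z - shanksCorrection n (suc k) z)
shanks-step n k k≤n z =
  subst (λ m → shanksTerm (suc m) k z ≡ shanksTerm m k z + (shanksCorrection m k z - shanksCorrection m (suc k) z))
        (ℕP.m+[n∸m]≡n k≤n) (split k (n ∸ k))
  where
  -- Writing n = k + L makes the numbers of factors explicit.
  split : ∀ k L → shanksTerm (suc (k ℕ.+ L)) k z
                ≡ shanksTerm (k ℕ.+ L) k z + (shanksCorrection (k ℕ.+ L) k z - shanksCorrection (k ℕ.+ L) (suc k) z)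
  split k L = begin
    shanksTerm (suc m) k z
      ≡⟨ cong (λ M → sgN k * prodFrom (suc k) M (z - + (24 ℕ.* shanksExp (suc m) k))) length+1 ⟩
    sgN k * prodFrom (suc k) (suc L) (z - + (24 ℕ.* shanksExp (suc m) k))
      ≡⟨ cong (sgN k *_) (prodFrom-last (suc k) L _) ⟩
    sgN k * (P (z - + (24 ℕ.* shanksExp (suc m) k)) - P (z - + (24 ℕ.* shanksExp (suc m) k) - + (24 ℕ.* (suc k ℕ.+ L))))
      ≡⟨ cong₂ (λ u v → sgN k * (P u - P v)) exp₁ exp₂ ⟩
    sgN k * (P (z₀ - + (24 ℕ.* k)) - P z₂)
      ≡⟨ l (sgN k) (P z₀) (P (z₀ - + (24 ℕ.* k))) (P z₂) ⟩
    sgN k * P z₀ + (- sgN k * (P z₀ - P (z₀ - + (24 ℕ.* k))) - (- - sgN k * P z₂))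
      ≡⟨ cong₂ (λ u v → sgN k * prodFrom (suc k) u z₀ + (- sgN k * v - (- - sgN k * prodFrom (suc k) u z₂)))
               (sym length) (cong (λ M → prodFrom k M z₀) (sym length+1)) ⟩
    shanksTerm m k z + (shanksCorrection m k z - shanksCorrection m (suc k) z) ∎
    where
    open ≡-Reasoning
    m = k ℕ.+ L
    P = prodFrom (suc k) L
    z₀ = z - + (24 ℕ.* shanksExp m k)
    z₂ = z - + (24 ℕ.* shanksExp m (suc k))
    length : m ∸ k ≡ L
    length = ℕP.m+n∸m≡n k L
    length+1 : suc m ∸ k ≡ suc L
    length+1 = trans (cong (_∸ k) (sym (ℕP.+-suc k L))) (ℕP.m+n∸m≡n k (suc L))
    exp₁ : z - + (24 ℕ.* shanksExp (suc m) k) ≡ z₀ - + (24 ℕ.* k)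
    exp₁ = trans (cong (λ w → z - + w) (e m k (tri k))) (sub-+ z _ _)
      where
      e : ∀ m k t → 24 ℕ.* ((k ℕ.+ m ℕ.* k) ℕ.+ t) ≡ 24 ℕ.* (m ℕ.* k ℕ.+ t) ℕ.+ 24 ℕ.* k
      e = ℕSolver.solve-∀
    exp₂ : z - + (24 ℕ.* shanksExp (suc m) k) - + (24 ℕ.* (suc k ℕ.+ L)) ≡ z₂
    exp₂ = trans (sym (sub-+ z _ _)) (cong (λ w → z - + w) (e k L (tri k)))
      where
      e : ∀ k L t → 24 ℕ.* ((k ℕ.+ (k ℕ.+ L) ℕ.* k) ℕ.+ t) ℕ.+ 24 ℕ.* ((1 ℕ.+ k) ℕ.+ L)
                  ≡ 24 ℕ.* ((k ℕ.+ L) ℕ.* (1 ℕ.+ k) ℕ.+ (t ℕ.+ (1 ℕ.+ k)))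
      e = ℕSolver.solve-∀
    l : ∀ s a b c → s * (b - c) ≡ s * a + (- s * (a - b) - (- - s * c))
    l = solve-∀

-- The pentagonal term (-1)^j q^{j(3j+1)/2} = ε(j) x^{(1+6j)² - 1}, as its
-- coefficient at exponent z.
pentagonalTerm : ℤ → ℤ → ℤ
pentagonalTerm z j = when (sq (+ 1 + + 6 * j)) (+ 1 + z) (χ₋₄ (+ 1 + + 6 * j))

tri-double : ∀ m → + 2 * + tri m ≡ + m * (+ 1 + + m)
tri-double zero    = refl
tri-double (suc m) = begin
  + 2 * + tri (suc m)                     ≡⟨ cong (_*_ (+ 2)) (trans (ℤP.pos-+ (tri m) (suc m)) (cong (_+_ (+ tri m)) (ℤP.pos-+ 1 m))) ⟩
  + 2 * (+ tri m + (+ 1 + + m))           ≡⟨ l₁ (+ tri m) (+ m) ⟩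
  + 2 * + tri m + + 2 * (+ 1 + + m)       ≡⟨ cong (_+ + 2 * (+ 1 + + m)) (tri-double m) ⟩
  + m * (+ 1 + + m) + + 2 * (+ 1 + + m)   ≡⟨ l₂ (+ m) ⟩
  (+ 1 + + m) * (+ 1 + (+ 1 + + m))       ≡⟨ cong (λ w → w * (+ 1 + w)) (sym (ℤP.pos-+ 1 m)) ⟩
  + suc m * (+ 1 + + suc m)               ∎
  where
  open ≡-Reasoning
  l₁ : ∀ t m → + 2 * (t + (+ 1 + m)) ≡ + 2 * t + + 2 * (+ 1 + m)
  l₁ = solve-∀
  l₂ : ∀ m → m * (+ 1 + m) + + 2 * (+ 1 + m) ≡ (+ 1 + m) * (+ 1 + (+ 1 + m))
  l₂ = solve-∀

shanksExp-ℤ : ∀ n k → + (24 ℕ.* shanksExp n k) ≡ + 24 * (+ n * + k + + tri k)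
shanksExp-ℤ n k = trans (ℤP.pos-* 24 (shanksExp n k)) (cong (_*_ (+ 24)) (trans (ℤP.pos-+ (n ℕ.* k) (tri k)) (cong (_+ + tri k) (ℤP.pos-* n k))))

-- The new exponents of Shanks' induction are the pentagonal numbers at ±(n+1):
-- 1 + 24(m² + t(m)) = (1 + 6m)²  and  1 + 24(n(n+1) + t(n+1)) = (1 - 6(n+1))².
exponent-nonneg : ∀ m → sq (+ 1 + + 6 * + m) ≡ + 1 + + (24 ℕ.* shanksExp m m)
exponent-nonneg m = sym (begin
  + 1 + + (24 ℕ.* shanksExp m m)                     ≡⟨ cong (_+_ (+ 1)) (shanksExp-ℤ m m) ⟩
  + 1 + + 24 * (+ m * + m + + tri m)                 ≡⟨ l₁ (+ m) (+ tri m) ⟩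
  + 1 + + 24 * (+ m * + m) + + 12 * (+ 2 * + tri m)  ≡⟨ cong (λ w → + 1 + + 24 * (+ m * + m) + + 12 * w) (tri-double m) ⟩
  + 1 + + 24 * (+ m * + m) + + 12 * (+ m * (+ 1 + + m)) ≡⟨ l₂ (+ m) ⟩
  sq (+ 1 + + 6 * + m)                               ∎)
  where
  open ≡-Reasoning
  l₁ : ∀ m t → + 1 + + 24 * (m * m + t) ≡ + 1 + + 24 * (m * m) + + 12 * (+ 2 * t)
  l₁ = solve-∀
  l₂ : ∀ m → + 1 + + 24 * (m * m) + + 12 * (m * (+ 1 + m)) ≡ (+ 1 + + 6 * m) * (+ 1 + + 6 * m)
  l₂ = solve-∀

exponent-neg : ∀ n → sq (+ 1 + + 6 * -[1+ n ]) ≡ + 1 + + (24 ℕ.* shanksExp n (suc n))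
exponent-neg n = sym (begin
  + 1 + + (24 ℕ.* shanksExp n (suc n))                                ≡⟨ cong (_+_ (+ 1)) (shanksExp-ℤ n (suc n)) ⟩
  + 1 + + 24 * (+ n * + suc n + + tri (suc n))                        ≡⟨ cong₂ (λ u v → + 1 + + 24 * (+ n * u + v)) (ℤP.pos-+ 1 n)
                                                                            (trans (ℤP.pos-+ (tri n) (suc n)) (cong (_+_ (+ tri n)) (ℤP.pos-+ 1 n))) ⟩
  + 1 + + 24 * (+ n * (+ 1 + + n) + (+ tri n + (+ 1 + + n)))          ≡⟨ l₁ (+ n) (+ tri n) ⟩
  + 1 + + 24 * (+ n * (+ 1 + + n) + (+ 1 + + n)) + + 12 * (+ 2 * + tri n)
                                                                      ≡⟨ cong (λ w → + 1 + + 24 * (+ n * (+ 1 + + n) + (+ 1 + + n)) + + 12 * w) (tri-double n) ⟩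
  + 1 + + 24 * (+ n * (+ 1 + + n) + (+ 1 + + n)) + + 12 * (+ n * (+ 1 + + n))
                                                                      ≡⟨ l₂ (+ n) ⟩
  sq (+ 1 + + 6 * - (+ 1 + + n))                                      ≡⟨ cong (λ w → sq (+ 1 + + 6 * - w)) (sym (ℤP.pos-+ 1 n)) ⟩
  sq (+ 1 + + 6 * -[1+ n ])                                           ∎)
  where
  open ≡-Reasoning
  l₁ : ∀ n t → + 1 + + 24 * (n * (+ 1 + n) + (t + (+ 1 + n))) ≡ + 1 + + 24 * (n * (+ 1 + n) + (+ 1 + n)) + + 12 * (+ 2 * t)
  l₁ = solve-∀
  l₂ : ∀ n → + 1 + + 24 * (n * (+ 1 + n) + (+ 1 + n)) + + 12 * (n * (+ 1 + n)) ≡ (+ 1 + + 6 * - (+ 1 + n)) * (+ 1 + + 6 * - (+ 1 + n))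
  l₂ = solve-∀

ε-sign : ∀ m → ε (+ m) ≡ sgN m
ε-sign zero    = refl
ε-sign (suc m) = trans (cong ε (ℤP.pos-+ 1 m)) (trans (ε-hom (+ 1) (+ m)) (trans (ℤP.-1*i≡-i (ε (+ m))) (cong -_ (ε-sign m))))

ε-sign-neg : ∀ n → ε -[1+ n ] ≡ sgN (suc n)
ε-sign-neg n = trans (ε-even (+ suc n)) (ε-sign (suc n))

pentagonalTerm-monomial : ∀ j E z s → sq (+ 1 + + 6 * j) ≡ + 1 + E → ε j ≡ s → pentagonalTerm z j ≡ s * δ (z - E)
pentagonalTerm-monomial j E z s exponent sign =
  trans (cong (when (sq (+ 1 + + 6 * j)) (+ 1 + z)) (trans (χ₋₄-pentagonal j) sign))
    (trans (when-iff s (λ e → trans (l₁ z E) (trans (cong₂ _-_ (sym e) (sym exponent)) (ℤP.+-inverseʳ (sq (+ 1 + + 6 * j)))))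
                       (λ e → trans exponent (sym (trans (l₂ E z) (trans (cong (λ w → + 1 + E + w) e) (ℤP.+-identityʳ _))))))
           (sym (trans (when-*ˡ (z - E) 0ℤ 1ℤ s) (cong (when (z - E) 0ℤ) (ℤP.*-identityʳ s)))))
  where
  l₁ : ∀ z E → z - E ≡ (+ 1 + z) - (+ 1 + E)
  l₁ = solve-∀
  l₂ : ∀ E z → + 1 + z ≡ + 1 + E + (z - E)
  l₂ = solve-∀

shanks : ∀ n z → sumN (suc n) (λ k → shanksTerm n k z) ≡ Σbox n (pentagonalTerm z)
shanks zero z =
  trans (ℤP.+-identityˡ _) (sym (trans (Σbox-zero (pentagonalTerm z)) (pentagonalTerm-monomial 0ℤ (+ 0) z 1ℤ refl refl)))
shanks (suc n) z = begin
  sumN (suc (suc n)) (λ k → S (suc n) k)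
    ≡⟨ cong (_+ S (suc n) (suc n)) (sumN-cong (suc n) (λ k k<1+n → shanks-step n k (ℕP.≤-pred k<1+n) z)) ⟩
  sumN (suc n) (λ k → S n k + (C k - C (suc k))) + S (suc n) (suc n)
    ≡⟨ cong (_+ S (suc n) (suc n)) (trans (sumN-+ (suc n) (S n) (λ k → C k - C (suc k)))
                                         (cong₂ _+_ (shanks n z) (sumN-telescope (suc n) C))) ⟩
  Σbox n pt + (C 0 - C (suc n)) + S (suc n) (suc n)
    ≡⟨ cong₂ (λ u v → Σbox n pt + u + v) (cong₂ _-_ C-first C-last) S-last ⟩
  Σbox n pt + (0ℤ - - sgN (suc n) * δ a) + sgN (suc n) * δ b
    ≡⟨ l (Σbox n pt) (sgN (suc n)) (δ a) (δ b) ⟩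
  sgN (suc n) * δ a + Σbox n pt + sgN (suc n) * δ b
    ≡⟨ sym (cong₂ (λ u v → u + Σbox n pt + v)
             (pentagonalTerm-monomial -[1+ n ] _ z _ (exponent-neg n) (ε-sign-neg n))
             (pentagonalTerm-monomial (+ suc n) _ z _ (exponent-nonneg (suc n)) (ε-sign (suc n)))) ⟩
  pt -[1+ n ] + Σbox n pt + pt (+ suc n)
    ≡⟨ sym (Σbox-suc n pt) ⟩
  Σbox (suc n) pt ∎
  where
  open ≡-Reasoning
  S : ℕ → ℕ → ℤ
  S m k = shanksTerm m k z
  C : ℕ → ℤ
  C k = shanksCorrection n k z
  pt = pentagonalTerm z
  a = z - + (24 ℕ.* shanksExp n (suc n))
  b = z - + (24 ℕ.* shanksExp (suc n) (suc n))
  C-first : C 0 ≡ 0ℤ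
  C-first = trans (ℤP.-1*i≡-i _) (cong -_ (trans (cong (λ w → prodFrom 1 n w′ - prodFrom 1 n w) (ℤP.+-identityʳ w′))
                                             (ℤP.+-inverseʳ (prodFrom 1 n w′))))
    where w′ = z - + (24 ℕ.* shanksExp n 0)
  C-last : C (suc n) ≡ - sgN (suc n) * δ a
  C-last = cong (λ M → - sgN (suc n) * prodFrom (suc n) M a) (ℕP.n∸n≡0 n)
  S-last : S (suc n) (suc n) ≡ sgN (suc n) * δ b
  S-last = cong (λ M → sgN (suc n) * prodFrom (suc (suc n)) M b) (ℕP.n∸n≡0 n)
  l : ∀ p s x y → p + (0ℤ - - s * x) + s * y ≡ s * x + p + s * y
  l = solve-∀

-- Euler's pentagonal number theorem, truncated: below x^{24(n+1)} the product
-- ∏_{i ≤ n} (1 - q^i) agrees with the pentagonal sum over |j| ≤ n, since all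
-- Shanks terms with k ≥ 1 start at exponent 24(n+1) or later.
prodCoef-pentagonal : ∀ n d → d ℕ.< 24 ℕ.* suc n → prodCoef n d ≡ Σbox n (pentagonalTerm (+ d))
prodCoef-pentagonal n d small = begin
  prodCoef n d                                              ≡⟨ prodCoef-prodFrom n d ⟩
  prodFrom 1 n (+ d)                                        ≡⟨ sym firstTerm ⟩
  shanksTerm n 0 (+ d)                                      ≡⟨ sym (ℤP.+-identityʳ _) ⟩
  shanksTerm n 0 (+ d) + 0ℤ                                 ≡⟨ cong (_+_ (shanksTerm n 0 (+ d))) (sym (sumN-vanish n _ laterTerms)) ⟩
  shanksTerm n 0 (+ d) + sumN n (λ k → shanksTerm n (suc k) (+ d)) ≡⟨ sym (sumN-shift n (λ k → shanksTerm n k (+ d))) ⟩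
  sumN (suc n) (λ k → shanksTerm n k (+ d))                 ≡⟨ shanks n (+ d) ⟩
  Σbox n (pentagonalTerm (+ d))                             ∎
  where
  open ≡-Reasoning
  firstTerm : shanksTerm n 0 (+ d) ≡ prodFrom 1 n (+ d)
  firstTerm = trans (ℤP.*-identityˡ _)
    (cong (prodFrom 1 n) (trans (cong (λ w → + d - + (24 ℕ.* w)) (trans (ℕP.+-identityʳ (n ℕ.* 0)) (ℕP.*-zeroʳ n)))
                                (ℤP.+-identityʳ (+ d))))
  late : ∀ k → suc n ≤ shanksExp n (suc k)
  late k = subst (_≤ shanksExp n (suc k)) (ℕP.+-comm n 1)
    (ℕP.+-mono-≤ (ℕP.m≤m*n n (suc k)) (ℕP.≤-trans (s≤s z≤n) (ℕP.m≤n+m (suc k) (tri k))))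
  laterTerms : ∀ k → shanksTerm n (suc k) (+ d) ≡ 0ℤ
  laterTerms k =
    trans (cong (λ w → sgN (suc k) * prodFrom (suc (suc k)) (n ∸ suc k) w)
                (sub-below d (24 ℕ.* shanksExp n (suc k)) (ℕP.<-≤-trans small (ℕP.*-monoʳ-≤ 24 (late k)))))
          (trans (cong (_*_ (sgN (suc k))) (prodFrom-negative (suc (suc k)) (n ∸ suc k) _)) (ℤP.*-zeroʳ (sgN (suc k))))

-- A pentagonal index is smaller than its exponent: |j| < |1 + 6j| ≤ (1 + 6j)².
pentagonal-index-linear : ∀ j → ∣ j ∣ ℕ.< ∣ + 1 + + 6 * j ∣
pentagonal-index-linear j = below ∣ j ∣ refl
  where
  triangle : 6 ℕ.* ∣ j ∣ ≤ ∣ + 1 + + 6 * j ∣ ℕ.+ 1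
  triangle = subst (_≤ ∣ + 1 + + 6 * j ∣ ℕ.+ 1) (trans (cong ∣_∣ (sym (l j))) (ℤP.∣i*j∣≡∣i∣*∣j∣ (+ 6) j))
                   (ℤP.∣i-j∣≤∣i∣+∣j∣ (+ 1 + + 6 * j) (+ 1))
    where
    l : ∀ j → + 6 * j ≡ (+ 1 + + 6 * j) - + 1
    l = solve-∀
  grow : ∀ a → (2 ℕ.+ a) ℕ.+ 1 ≤ 6 ℕ.* (1 ℕ.+ a)
  grow a = subst ((2 ℕ.+ a) ℕ.+ 1 ≤_) (e a) (ℕP.m≤m+n ((2 ℕ.+ a) ℕ.+ 1) (3 ℕ.+ 5 ℕ.* a))
    where
    e : ∀ a → (2 ℕ.+ a) ℕ.+ 1 ℕ.+ (3 ℕ.+ 5 ℕ.* a) ≡ 6 ℕ.* (1 ℕ.+ a)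
    e = ℕSolver.solve-∀
  below : ∀ a → ∣ j ∣ ≡ a → a ℕ.< ∣ + 1 + + 6 * j ∣
  below zero    j≡0   = subst (λ x → 0 ℕ.< ∣ + 1 + + 6 * x ∣) (sym (ℤP.∣i∣≡0⇒i≡0 {j} j≡0)) (s≤s z≤n)
  below (suc a) j≡1+a =
    ℕP.+-cancelʳ-≤ 1 _ _ (ℕP.≤-trans (grow a) (subst (λ b → 6 ℕ.* b ≤ ∣ + 1 + + 6 * j ∣ ℕ.+ 1) j≡1+a triangle))

pentagonal-index-bound : ∀ j → ∣ j ∣ ℕ.< ∣ sq (+ 1 + + 6 * j) ∣
pentagonal-index-bound j =
  ℕP.<-≤-trans (pentagonal-index-linear j)
    (subst (∣ + 1 + + 6 * j ∣ ≤_) (sym (ℤP.∣i*j∣≡∣i∣*∣j∣ (+ 1 + + 6 * j) (+ 1 + + 6 * j))) (n≤n*n ∣ + 1 + + 6 * j ∣))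

pentagonal-support : ∀ j k → sq (+ 1 + + 6 * j) ≡ + k → ∣ j ∣ ℕ.< k
pentagonal-support j k e = subst (λ w → ∣ j ∣ ℕ.< ∣ w ∣) e (pentagonal-index-bound j)

etaCoef-pentagonal : ∀ N k → k ≤ N → etaCoef k ≡ Σbox N (λ j → when (sq (+ 1 + + 6 * j)) (+ k) (χ₋₄ (+ 1 + + 6 * j)))
etaCoef-pentagonal N zero    _ =
  sym (ΣL-vanish (box N) _ (λ j → when-no {sq (+ 1 + + 6 * j)} {+ 0} _ (λ e → ℕP.n≮0 (pentagonal-support j 0 e))))
etaCoef-pentagonal N (suc d) 1+d≤N =
  trans (prodCoef-pentagonal d d (ℕP.<-≤-trans (ℕP.n<1+n d) (ℕP.m≤n*m (suc d) 24)))
        (sym (Σbox-widen d N (pentagonalTerm (+ d)) (ℕP.≤-trans (ℕP.n≤1+n d) 1+d≤N)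
               (λ j d<j → when-no {sq (+ 1 + + 6 * j)} {+ suc d} _ (λ e → ℕP.<⇒≱ d<j (ℕP.≤-pred (pentagonal-support j (suc d) e))))))

half : ℤ → ℤ
half x = x /ℕ 2

half-odd : ∀ u → half (+ 1 + + 2 * u) ≡ u
half-odd u = trans (cong half (l u)) (div-of 2 1 u (s≤s (s≤s z≤n)))
  where
  l : ∀ u → + 1 + + 2 * u ≡ + 1 + u * + 2
  l = solve-∀

half-even : ∀ u → half (+ 2 * u) ≡ u
half-even u = trans (cong half (l u)) (div-of 2 0 u (s≤s z≤n))
  where
  l : ∀ u → + 2 * u ≡ + 0 + u * + 2
  l = solve-∀

leg3-residue : ∀ ρ p → leg3 (+ ρ + + 3 * p) ≡ leg3 (+ ρ)
leg3-residue ρ p = trans (cong leg3 (l (+ ρ) p)) (leg3-periodic (+ ρ) p)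
  where
  l : ∀ a p → a + + 3 * p ≡ a + p * + 3
  l = solve-∀

-- For fixed s and K, the slices
--   Σ_t [(3t - 2s)² = K] χ₋₄(t) ε(s)        (from ϑ_a ϑ_b ϑ_{a+b})
--   Σ_j [(1 + 6j)² = K] χ₋₄(1 + 6j) (s/3)  (from η · S)
-- are negatives of each other; this is the heart of the identity.
thetaSlice : ℤ → ℤ → ℤ → ℤ
thetaSlice s K t = when (sq (+ 3 * t - + 2 * s)) K (χ₋₄ t * ε s)

etaSlice : ℤ → ℤ → ℤ → ℤ
etaSlice s K j = when (sq (+ 1 + + 6 * j)) K (χ₋₄ (+ 1 + + 6 * j) * leg3 s)

thetaSlice-support : ∀ N s K t → ∣ s ∣ ≤ N → K ℤ.≤ + N → ¬ thetaSlice s K t ≡ 0ℤ → ∣ t ∣ ≤ N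
thetaSlice-support N s K t s≤N K≤N nz = ℕP.*-cancelˡ-≤ 3 (begin
  3 ℕ.* ∣ t ∣                          ≡⟨ sym (trans (cong ∣_∣ (l t s)) (ℤP.∣i*j∣≡∣i∣*∣j∣ (+ 3) t)) ⟩
  ∣ u + + 2 * s ∣                      ≤⟨ ℤP.∣i+j∣≤∣i∣+∣j∣ u (+ 2 * s) ⟩
  ∣ u ∣ ℕ.+ ∣ + 2 * s ∣                ≡⟨ cong (∣ u ∣ ℕ.+_) (ℤP.∣i*j∣≡∣i∣*∣j∣ (+ 2) s) ⟩
  ∣ u ∣ ℕ.+ 2 ℕ.* ∣ s ∣                ≤⟨ ℕP.+-mono-≤ u≤N (ℕP.*-monoʳ-≤ 2 s≤N) ⟩
  N ℕ.+ 2 ℕ.* N                        ≡⟨ e N ⟩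
  3 ℕ.* N                              ∎)
  where
  open ℕP.≤-Reasoning
  u = + 3 * t - + 2 * s
  u≤N : ∣ u ∣ ≤ N
  u≤N = square-bound-≤ u K N (proj₁ (when-nonzero nz)) K≤N
  l : ∀ t s → (+ 3 * t - + 2 * s) + + 2 * s ≡ + 3 * t
  l = solve-∀
  e : ∀ N → N ℕ.+ 2 ℕ.* N ≡ 3 ℕ.* N
  e = ℕSolver.solve-∀

etaSlice-support : ∀ N s K j → K ℤ.≤ + N → ¬ - etaSlice s K j ≡ 0ℤ → ∣ j ∣ ≤ N
etaSlice-support N s K j K≤N nz =
  ℕP.<⇒≤ (ℕP.<-≤-trans (pentagonal-index-linear j)
    (square-bound-≤ (+ 1 + + 6 * j) K N (proj₁ (when-nonzero (λ e → nz (cong -_ e)))) K≤N))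

-- The residue classes s ≢ 0 (mod 3): a bijection t = ψ(j) between odd t and
-- all j matches the slices term by term.
slice-by-bijection : ∀ N s K (ψ φ : ℤ → ℤ) → ∣ s ∣ ≤ N → K ℤ.≤ + N →
  (∀ j → thetaSlice s K (ψ j) ≡ - etaSlice s K j) → (∀ j → φ (ψ j) ≡ j) →
  (∀ u → ψ (φ (+ 1 + + 2 * u)) ≡ + 1 + + 2 * u) →
  Σbox N (thetaSlice s K) ≡ - Σbox N (etaSlice s K)
slice-by-bijection N s K ψ φ s≤N K≤N matches φψ ψφ-odd =
  trans (reindex (thetaSlice s K) (λ j → - etaSlice s K j) φ ψ
                 (λ t → thetaSlice-support N s K t s≤N K≤N) (λ j → etaSlice-support N s K j K≤N)
                 forward (λ j _ → φψ j , matches j))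
        (ΣL-neg (box N) (etaSlice s K))
  where
  open Reindex (boxSum N) (boxSum N) (ΣL-swap (box N) (box N))
  ψφ : ∀ t → ¬ thetaSlice s K t ≡ 0ℤ → ψ (φ t) ≡ t
  ψφ t nz with odd-witness t (λ e → proj₂ (when-nonzero nz) (cong (_* ε s) e))
  ... | u , refl = ψφ-odd u
  forward : ∀ t → ¬ thetaSlice s K t ≡ 0ℤ → ψ (φ t) ≡ t × - etaSlice s K (φ t) ≡ thetaSlice s K t
  forward t nz = ψφ t nz , trans (sym (matches (φ t))) (cong (thetaSlice s K) (ψφ t nz))

-- s = 1 + 3p: t = 1 + 2(j + p), and 3t - 2s = 1 + 6j.
slice-identity-1 : ∀ N K {s} p → s ≡ + 1 + + 3 * p → ∣ s ∣ ≤ N → K ℤ.≤ + N →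
  Σbox N (thetaSlice s K) ≡ - Σbox N (etaSlice s K)
slice-identity-1 N K {s} p refl s≤N K≤N = slice-by-bijection N s K ψ φ s≤N K≤N matches φψ ψφ
  where
  ψ φ : ℤ → ℤ
  ψ j = + 1 + + 2 * (j + p)
  φ t = half t - p
  weight : ∀ j → χ₋₄ (ψ j) * ε s ≡ - (χ₋₄ (+ 1 + + 6 * j) * leg3 s)
  weight j = begin
    ε (j + p) * ε (+ 1 + + 3 * p)       ≡⟨ cong₂ _*_ (ε-hom j p) (trans (ε-hom (+ 1) (+ 3 * p)) (cong (ε (+ 1) *_) (ε-triple p))) ⟩
    ε j * ε p * (- 1ℤ * ε p)            ≡⟨ l (ε j) (ε p) ⟩
    - (ε j * ε p * ε p)                 ≡⟨ cong -_ (ε-cancel p (ε j)) ⟩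
    - ε j                               ≡⟨ cong -_ (sym (trans (cong₂ _*_ (χ₋₄-pentagonal j) (leg3-residue 1 p)) (ℤP.*-identityʳ (ε j)))) ⟩
    - (χ₋₄ (+ 1 + + 6 * j) * leg3 s)    ∎
    where
    open ≡-Reasoning
    l : ∀ a b → a * b * (- 1ℤ * b) ≡ - (a * b * b)
    l = solve-∀
  matches : ∀ j → thetaSlice s K (ψ j) ≡ - etaSlice s K j
  matches j = trans (cong (λ u → when (sq u) K (χ₋₄ (ψ j) * ε s)) (l j p))
                    (trans (cong (when (sq (+ 1 + + 6 * j)) K) (weight j))
                           (sym (when-neg (sq (+ 1 + + 6 * j)) K (χ₋₄ (+ 1 + + 6 * j) * leg3 s))))
    where
    l : ∀ j p → + 3 * (+ 1 + + 2 * (j + p)) - + 2 * (+ 1 + + 3 * p) ≡ + 1 + + 6 * j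
    l = solve-∀
  φψ : ∀ j → φ (ψ j) ≡ j
  φψ j = trans (cong (_- p) (half-odd (j + p))) (l j p)
    where
    l : ∀ j p → j + p - p ≡ j
    l = solve-∀
  ψφ : ∀ u → ψ (φ (+ 1 + + 2 * u)) ≡ + 1 + + 2 * u
  ψφ u = trans (cong (λ w → ψ (w - p)) (half-odd u)) (l u p)
    where
    l : ∀ u p → + 1 + + 2 * (u - p + p) ≡ + 1 + + 2 * u
    l = solve-∀

-- s = 2 + 3p: t = 1 + 2(p - j), and 3t - 2s = -(1 + 6j).
slice-identity-2 : ∀ N K {s} p → s ≡ + 2 + + 3 * p → ∣ s ∣ ≤ N → K ℤ.≤ + N →
  Σbox N (thetaSlice s K) ≡ - Σbox N (etaSlice s K)
slice-identity-2 N K {s} p refl s≤N K≤N = slice-by-bijection N s K ψ φ s≤N K≤N matches φψ ψφ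
  where
  ψ φ : ℤ → ℤ
  ψ j = + 1 + + 2 * (p - j)
  φ t = p - half t
  weight : ∀ j → χ₋₄ (ψ j) * ε s ≡ - (χ₋₄ (+ 1 + + 6 * j) * leg3 s)
  weight j = begin
    ε (p - j) * ε (+ 2 + + 3 * p)       ≡⟨ cong₂ _*_ (trans (ε-hom p (- j)) (cong (ε p *_) (ε-even j)))
                                                    (trans (ε-hom (+ 2) (+ 3 * p)) (cong (ε (+ 2) *_) (ε-triple p))) ⟩
    ε p * ε j * (1ℤ * ε p)              ≡⟨ l (ε j) (ε p) ⟩
    ε j * ε p * ε p                     ≡⟨ ε-cancel p (ε j) ⟩
    ε j                                 ≡⟨ sym (trans (cong (λ w → - (w * leg3 s)) (χ₋₄-pentagonal j))
                                                 (trans (cong (λ w → - (ε j * w)) (leg3-residue 2 p)) (l′ (ε j)))) ⟩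
    - (χ₋₄ (+ 1 + + 6 * j) * leg3 s)    ∎
    where
    open ≡-Reasoning
    l : ∀ a b → b * a * (1ℤ * b) ≡ a * b * b
    l = solve-∀
    l′ : ∀ a → - (a * - 1ℤ) ≡ a
    l′ = solve-∀
  matches : ∀ j → thetaSlice s K (ψ j) ≡ - etaSlice s K j
  matches j = trans (cong (λ u → when u K (χ₋₄ (ψ j) * ε s)) (l j p))
                    (trans (cong (when (sq (+ 1 + + 6 * j)) K) (weight j))
                           (sym (when-neg (sq (+ 1 + + 6 * j)) K (χ₋₄ (+ 1 + + 6 * j) * leg3 s))))
    where
    l : ∀ j p → (+ 3 * (+ 1 + + 2 * (p - j)) - + 2 * (+ 2 + + 3 * p)) * (+ 3 * (+ 1 + + 2 * (p - j)) - + 2 * (+ 2 + + 3 * p))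
              ≡ (+ 1 + + 6 * j) * (+ 1 + + 6 * j)
    l = solve-∀
  φψ : ∀ j → φ (ψ j) ≡ j
  φψ j = trans (cong (_-_ p) (half-odd (p - j))) (l j p)
    where
    l : ∀ j p → p - (p - j) ≡ j
    l = solve-∀
  ψφ : ∀ u → ψ (φ (+ 1 + + 2 * u)) ≡ + 1 + + 2 * u
  ψφ u = trans (cong (λ w → ψ (p - w)) (half-odd u)) (l u p)
    where
    l : ∀ u p → + 1 + + 2 * (p - (p - u)) ≡ + 1 + + 2 * u
    l = solve-∀

-- The residue class s ≡ 0 (mod 3): here (s/3) = 0, and t ↦ 4s/3 - t is an
-- involution negating the θ-slice.
slice-identity-0 : ∀ N K {s} p → s ≡ + 3 * p → ∣ s ∣ ≤ N → K ℤ.≤ + N →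
  Σbox N (thetaSlice s K) ≡ - Σbox N (etaSlice s K)
slice-identity-0 N K {s} p refl s≤N K≤N =
  trans (vanish-by-involution (thetaSlice s K) ι (λ t → thetaSlice-support N s K t s≤N K≤N) antisymmetric)
        (sym (cong -_ (ΣL-vanish (box N) (etaSlice s K)
          (λ j → trans (cong (when (sq (+ 1 + + 6 * j)) K) (legendre-zero j)) (when-zero (sq (+ 1 + + 6 * j)) K)))))
  where
  open Involution (boxSum N) (ΣL-swap (box N) (box N)) (ΣL-neg (box N))
  ι : ℤ → ℤ
  ι t = + 4 * p - t
  legendre-zero : ∀ j → χ₋₄ (+ 1 + + 6 * j) * leg3 s ≡ 0ℤ
  legendre-zero j = trans (cong (χ₋₄ (+ 1 + + 6 * j) *_) (trans (cong leg3 (sym (ℤP.+-identityˡ s))) (leg3-residue 0 p)))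
                          (ℤP.*-zeroʳ (χ₋₄ (+ 1 + + 6 * j)))
  reflect : ∀ t → χ₋₄ (ι t) ≡ - χ₋₄ t
  reflect t = trans (cong χ₋₄ (l p t)) (trans (χ₋₄-periodic (- t) p) (χ₋₄-odd t))
    where
    l : ∀ p t → + 4 * p - t ≡ - t + p * + 4
    l = solve-∀
  antisymmetric : ∀ t → ¬ thetaSlice s K t ≡ 0ℤ → ι (ι t) ≡ t × thetaSlice s K (ι t) ≡ - thetaSlice s K t
  antisymmetric t _ = l₁ p t ,
    trans (cong (λ u → when u K (χ₋₄ (ι t) * ε s)) (l₂ p t))
      (trans (cong (when (sq (+ 3 * t - + 2 * s)) K) (trans (cong (_* ε s) (reflect t)) (sym (ℤP.neg-distribˡ-* (χ₋₄ t) (ε s)))))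
             (sym (when-neg (sq (+ 3 * t - + 2 * s)) K (χ₋₄ t * ε s))))
    where
    l₁ : ∀ p t → + 4 * p - (+ 4 * p - t) ≡ t
    l₁ = solve-∀
    l₂ : ∀ p t → (+ 3 * (+ 4 * p - t) - + 2 * (+ 3 * p)) * (+ 3 * (+ 4 * p - t) - + 2 * (+ 3 * p))
               ≡ (+ 3 * t - + 2 * (+ 3 * p)) * (+ 3 * t - + 2 * (+ 3 * p))
    l₂ = solve-∀

slice-identity : ∀ N s K → ∣ s ∣ ≤ N → K ℤ.≤ + N → Σbox N (thetaSlice s K) ≡ - Σbox N (etaSlice s K)
slice-identity N s K with residue 3 s
... | 0 , p , _ , refl = slice-identity-0 N K p (l p)
  where
  l : ∀ p → + 0 + p * + 3 ≡ + 3 * p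
  l = solve-∀
... | 1 , p , _ , refl = slice-identity-1 N K p (l p)
  where
  l : ∀ p → + 1 + p * + 3 ≡ + 1 + + 3 * p
  l = solve-∀
... | 2 , p , _ , refl = slice-identity-2 N K p (l p)
  where
  l : ∀ p → + 2 + p * + 3 ≡ + 2 + + 3 * p
  l = solve-∀
... | suc (suc (suc _)) , _ , s≤s (s≤s (s≤s ())) , _

-- The quadratic form Q(r,s) = 3r² + 3rs + s² (the exponent of q in S is Q/3)
-- and the linear form giving the exponent of y = ζ^{1/2} in S.
Q : ℤ → ℤ → ℤ
Q r s = + 3 * sq r + + 3 * (r * s) + sq s

linearForm : ℤ → ℤ → ℤ → ℤ → ℤ
linearForm a b r s = + 2 * ((a - b) * r + a * s)

-- 8Q is a sum of squares: 8Q = s² + 6(2r + s)² + s² = r² + 2(2s + 3r)² + 5r².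
Q-nonneg : ∀ r s → 0ℤ ℤ.≤ + 8 * Q r s
Q-nonneg r s = subst (0ℤ ℤ.≤_) (sym (l r s))
  (nonneg-+ (sq-nonneg s) (nonneg-+ (nonneg-scale 6 (sq-nonneg (+ 2 * r + s))) (sq-nonneg s)))
  where
  l : ∀ r s → + 8 * (+ 3 * (r * r) + + 3 * (r * s) + s * s) ≡ s * s + (+ 6 * ((+ 2 * r + s) * (+ 2 * r + s)) + s * s)
  l = solve-∀

Q-bound : ∀ r s M → + 8 * Q r s ≡ + M → ∣ r ∣ ≤ M × ∣ s ∣ ≤ M
Q-bound r s M e =
  square-bound r _ M (trans (sym (l₁ r s)) e) (nonneg-+ (nonneg-scale 2 (sq-nonneg (+ 2 * s + + 3 * r))) (nonneg-scale 5 (sq-nonneg r))) ,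
  square-bound s _ M (trans (sym (l₂ r s)) e) (nonneg-+ (nonneg-scale 6 (sq-nonneg (+ 2 * r + s))) (sq-nonneg s))
  where
  l₁ : ∀ r s → + 8 * (+ 3 * (r * r) + + 3 * (r * s) + s * s) ≡ r * r + (+ 2 * ((+ 2 * s + + 3 * r) * (+ 2 * s + + 3 * r)) + + 5 * (r * r))
  l₁ = solve-∀
  l₂ : ∀ r s → + 8 * (+ 3 * (r * r) + + 3 * (r * s) + s * s) ≡ s * s + (+ 6 * ((+ 2 * r + s) * (+ 2 * r + s)) + s * s)
  l₂ = solve-∀

residual : ℕ → ℤ → ℤ → ℤ
residual N r s = + N - + 8 * Q r s

residual-bound : ∀ N r s → residual N r s ℤ.≤ + N
residual-bound N r s =
  subst (residual N r s ℤ.≤_) (ℤP.+-identityʳ (+ N)) (ℤP.+-monoʳ-≤ (+ N) (ℤP.neg-mono-≤ (Q-nonneg r s)))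

-- The change of variables (t, r, s) ↦ (r₁, r₂, r₃) = (2(s+r) - t, -2r - t, t)
-- maps ℤ³ bijectively onto the triples of integers of equal parity; it carries
--   3(r₁² + r₂² + r₃²)  to  (3t - 2s)² + 8Q(r,s),
--   a r₁ + b r₂ + (a+b) r₃  to  2((a-b)r + as),
--   χ₋₄(r₁) χ₋₄(r₂) χ₋₄(r₃)  to  χ₋₄(t) ε(s).
substitute : Triple → Triple
substitute (t , r , s) = (+ 2 * (s + r) - t , - (+ 2 * r) - t , t)

-- Its inverse on triples of equal parity.
unsubstitute : Triple → Triple
unsubstitute (r₁ , r₂ , r₃) = (r₃ , - half (r₂ + r₃) , half (r₁ + r₃) + half (r₂ + r₃))

-- The weight: χ₋₄(-t + 2y) = -χ₋₄(t) ε(y), and ε is a ±1-valued character.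
substitution-weight : ∀ t r s → χ₋₄ (+ 2 * (s + r) - t) * χ₋₄ (- (+ 2 * r) - t) * χ₋₄ t ≡ χ₋₄ t * ε s
substitution-weight t r s = begin
  χ₋₄ (+ 2 * (s + r) - t) * χ₋₄ (- (+ 2 * r) - t) * χ₋₄ t
    ≡⟨ cong₂ (λ u v → u * v * χ₋₄ t) (shifted (s + r) (l₁ s r t)) (shifted (- r) (l₂ r t)) ⟩
  (- χ₋₄ t * ε (s + r)) * (- χ₋₄ t * ε (- r)) * χ₋₄ t
    ≡⟨ cong₂ (λ u v → (- χ₋₄ t * u) * (- χ₋₄ t * v) * χ₋₄ t) (ε-hom s r) (ε-even r) ⟩
  (- χ₋₄ t * (ε s * ε r)) * (- χ₋₄ t * ε r) * χ₋₄ t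
    ≡⟨ l₃ (χ₋₄ t) (ε s) (ε r) ⟩
  χ₋₄ t * χ₋₄ t * χ₋₄ t * ε s * ε r * ε r
    ≡⟨ ε-cancel r _ ⟩
  χ₋₄ t * χ₋₄ t * χ₋₄ t * ε s
    ≡⟨ cong (_* ε s) (χ₋₄-cube t) ⟩
  χ₋₄ t * ε s ∎
  where
  open ≡-Reasoning
  shifted : ∀ y {x} → x ≡ - t + + 2 * y → χ₋₄ x ≡ - χ₋₄ t * ε y
  shifted y refl = trans (χ₋₄-shift (- t) y) (cong (_* ε y) (χ₋₄-odd t))
  l₁ : ∀ s r t → + 2 * (s + r) - t ≡ - t + + 2 * (s + r)
  l₁ = solve-∀
  l₂ : ∀ r t → - (+ 2 * r) - t ≡ - t + + 2 * (- r)
  l₂ = solve-∀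
  l₃ : ∀ c e f → (- c * (e * f)) * (- c * f) * c ≡ c * c * c * e * f * f
  l₃ = solve-∀

nonzero-factors : ∀ {x y z} → ¬ x * y * z ≡ 0ℤ → ¬ x ≡ 0ℤ × ¬ y ≡ 0ℤ × ¬ z ≡ 0ℤ
nonzero-factors {x} {y} {z} nz =
  (λ { refl → nz refl }) ,
  (λ { refl → nz (cong (_* z) (ℤP.*-zeroʳ x)) }) ,
  (λ { refl → nz (ℤP.*-zeroʳ (x * y)) })

module ThetaProduct (a b : ℤ) (N : ℕ) (m : ℤ) where

  thetaTerm : Triple → ℤ
  thetaTerm (r₁ , r₂ , r₃) =
    when (+ 3 * (sq r₁ + sq r₂ + sq r₃)) (+ N) (when (a * r₁ + b * r₂ + (a + b) * r₃) m (χ₋₄ r₁ * χ₋₄ r₂ * χ₋₄ r₃))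

  thetaTerm-substitute : ∀ t r s →
    thetaTerm (substitute (t , r , s)) ≡ when (linearForm a b r s) m (thetaSlice s (residual N r s) t)
  thetaTerm-substitute t r s = begin
    thetaTerm (substitute (t , r , s))
      ≡⟨ when-comm (E r₁ r₂) (+ N) (a * r₁ + b * r₂ + (a + b) * t) m w ⟩
    when (a * r₁ + b * r₂ + (a + b) * t) m (when (E r₁ r₂) (+ N) w)
      ≡⟨ cong (λ u → when u m (when (E r₁ r₂) (+ N) w)) (l₁ a b t r s) ⟩
    when L m (when (E r₁ r₂) (+ N) w)
      ≡⟨ cong (λ u → when L m (when u (+ N) w)) (l₂ t r s) ⟩
    when L m (when (sq (+ 3 * t - + 2 * s) + + 8 * Q r s) (+ N) w)
      ≡⟨ cong (when L m) (when-shift (sq (+ 3 * t - + 2 * s)) (+ 8 * Q r s) (+ N) w) ⟩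
    when L m (when (sq (+ 3 * t - + 2 * s)) (residual N r s) w)
      ≡⟨ cong (λ v → when L m (when (sq (+ 3 * t - + 2 * s)) (residual N r s) v)) (substitution-weight t r s) ⟩
    when L m (thetaSlice s (residual N r s) t) ∎
    where
    open ≡-Reasoning
    r₁ = + 2 * (s + r) - t
    r₂ = - (+ 2 * r) - t
    L = linearForm a b r s
    w = χ₋₄ r₁ * χ₋₄ r₂ * χ₋₄ t
    E : ℤ → ℤ → ℤ
    E r₁ r₂ = + 3 * (sq r₁ + sq r₂ + sq t)
    l₁ : ∀ a b t r s → a * (+ 2 * (s + r) - t) + b * (- (+ 2 * r) - t) + (a + b) * t ≡ + 2 * ((a - b) * r + a * s)
    l₁ = solve-∀
    l₂ : ∀ t r s → + 3 * ((+ 2 * (s + r) - t) * (+ 2 * (s + r) - t) + (- (+ 2 * r) - t) * (- (+ 2 * r) - t) + t * t)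
                 ≡ (+ 3 * t - + 2 * s) * (+ 3 * t - + 2 * s) + + 8 * (+ 3 * (r * r) + + 3 * (r * s) + s * s)
    l₂ = solve-∀

  thetaTerm-nonzero : ∀ {r₁ r₂ r₃} → ¬ thetaTerm (r₁ , r₂ , r₃) ≡ 0ℤ →
    + 3 * (sq r₁ + sq r₂ + sq r₃) ≡ + N × ¬ χ₋₄ r₁ * χ₋₄ r₂ * χ₋₄ r₃ ≡ 0ℤ
  thetaTerm-nonzero {r₁} {r₂} {r₃} nz with when-nonzero {+ 3 * (sq r₁ + sq r₂ + sq r₃)} {+ N} {inner} nz
    where
    inner = when (a * r₁ + b * r₂ + (a + b) * r₃) m (χ₋₄ r₁ * χ₋₄ r₂ * χ₋₄ r₃)
  ... | condition , inner≢0 = condition , proj₂ (when-nonzero {a * r₁ + b * r₂ + (a + b) * r₃} {m} inner≢0)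

  thetaTerm-support : ∀ x → ¬ thetaTerm x ≡ 0ℤ → InCube N x
  thetaTerm-support (r₁ , r₂ , r₃) nz =
    square-bound r₁ _ N (trans (sym (l₁ r₁ r₂ r₃)) e)
      (nonneg-+ (nonneg-+ (nonneg-scale 2 (sq-nonneg r₁)) (nonneg-scale 3 (sq-nonneg r₂))) (nonneg-scale 3 (sq-nonneg r₃))) ,
    square-bound r₂ _ N (trans (sym (l₂ r₁ r₂ r₃)) e)
      (nonneg-+ (nonneg-+ (nonneg-scale 3 (sq-nonneg r₁)) (nonneg-scale 2 (sq-nonneg r₂))) (nonneg-scale 3 (sq-nonneg r₃))) ,
    square-bound r₃ _ N (trans (sym (l₃ r₁ r₂ r₃)) e)
      (nonneg-+ (nonneg-+ (nonneg-scale 3 (sq-nonneg r₁)) (nonneg-scale 3 (sq-nonneg r₂))) (nonneg-scale 2 (sq-nonneg r₃)))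
    where
    e = proj₁ (thetaTerm-nonzero {r₁} {r₂} {r₃} nz)
    l₁ : ∀ a b c → + 3 * (a * a + b * b + c * c) ≡ a * a + (+ 2 * (a * a) + + 3 * (b * b) + + 3 * (c * c))
    l₁ = solve-∀
    l₂ : ∀ a b c → + 3 * (a * a + b * b + c * c) ≡ b * b + (+ 3 * (a * a) + + 2 * (b * b) + + 3 * (c * c))
    l₂ = solve-∀
    l₃ : ∀ a b c → + 3 * (a * a + b * b + c * c) ≡ c * c + (+ 3 * (a * a) + + 3 * (b * b) + + 2 * (c * c))
    l₃ = solve-∀

  substituted-support : ∀ y → ¬ thetaTerm (substitute y) ≡ 0ℤ → InCube N y
  substituted-support (t , r , s) nz =
    proj₂ (proj₂ (thetaTerm-support (substitute (t , r , s)) nz)) ,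
    square-bound r _ N (trans (sym (l₁ t r s)) e)
      (nonneg-+ (nonneg-+ (sq-nonneg (+ 3 * t - + 2 * s)) (nonneg-scale 2 (sq-nonneg (+ 2 * s + + 3 * r)))) (nonneg-scale 5 (sq-nonneg r))) ,
    square-bound s _ N (trans (sym (l₂ t r s)) e)
      (nonneg-+ (nonneg-+ (sq-nonneg (+ 3 * t - + 2 * s)) (nonneg-scale 6 (sq-nonneg (+ 2 * r + s)))) (sq-nonneg s))
    where
    e = proj₁ (thetaTerm-nonzero {+ 2 * (s + r) - t} { - (+ 2 * r) - t} {t} nz)
    l₁ : ∀ t r s → + 3 * ((+ 2 * (s + r) - t) * (+ 2 * (s + r) - t) + (- (+ 2 * r) - t) * (- (+ 2 * r) - t) + t * t)
                 ≡ r * r + ((+ 3 * t - + 2 * s) * (+ 3 * t - + 2 * s) + + 2 * ((+ 2 * s + + 3 * r) * (+ 2 * s + + 3 * r)) + + 5 * (r * r))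
    l₁ = solve-∀
    l₂ : ∀ t r s → + 3 * ((+ 2 * (s + r) - t) * (+ 2 * (s + r) - t) + (- (+ 2 * r) - t) * (- (+ 2 * r) - t) + t * t)
                 ≡ s * s + ((+ 3 * t - + 2 * s) * (+ 3 * t - + 2 * s) + + 6 * ((+ 2 * r + s) * (+ 2 * r + s)) + s * s)
    l₂ = solve-∀

  unsubstitute-substitute : ∀ y → unsubstitute (substitute y) ≡ y
  unsubstitute-substitute (t , r , s) =
    cong (t ,_) (cong₂ _,_ (trans (cong -_ second) (ℤP.neg-involutive r)) (trans (cong₂ _+_ first second) (l₃ r s)))
    where
    second : half (- (+ 2 * r) - t + t) ≡ - r
    second = trans (cong half (l₁ r t)) (half-even (- r))
      where
      l₁ : ∀ r t → - (+ 2 * r) - t + t ≡ + 2 * (- r)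
      l₁ = solve-∀
    first : half (+ 2 * (s + r) - t + t) ≡ s + r
    first = trans (cong half (l₂ s r t)) (half-even (s + r))
      where
      l₂ : ∀ s r t → + 2 * (s + r) - t + t ≡ + 2 * (s + r)
      l₂ = solve-∀
    l₃ : ∀ r s → s + r + - r ≡ s
    l₃ = solve-∀

  -- Only triples of odd integers contribute, and on them the substitution is onto.
  substitute-unsubstitute : ∀ x → ¬ thetaTerm x ≡ 0ℤ → substitute (unsubstitute x) ≡ x
  substitute-unsubstitute (r₁ , r₂ , r₃) nz
    with nonzero-factors (proj₂ (thetaTerm-nonzero {r₁} {r₂} {r₃} nz))
  ... | χr₁≢0 , χr₂≢0 , χr₃≢0
    with odd-witness r₁ χr₁≢0 | odd-witness r₂ χr₂≢0 | odd-witness r₃ χr₃≢0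
  ... | u₁ , refl | u₂ , refl | u₃ , refl =
    trans (cong substitute (cong (r₃′ ,_) (cong₂ _,_ (cong -_ halfV) (cong₂ _+_ halfU halfV))))
          (cong₂ _,_ (l₃ u₁ u₂ u₃) (cong₂ _,_ (l₄ u₁ u₂ u₃) refl))
    where
    r₃′ = + 1 + + 2 * u₃
    l₁ : ∀ a c → (+ 1 + + 2 * a) + (+ 1 + + 2 * c) ≡ + 2 * (+ 1 + a + c)
    l₁ = solve-∀
    halfU : half ((+ 1 + + 2 * u₁) + r₃′) ≡ + 1 + u₁ + u₃
    halfU = trans (cong half (l₁ u₁ u₃)) (half-even _)
    halfV : half ((+ 1 + + 2 * u₂) + r₃′) ≡ + 1 + u₂ + u₃
    halfV = trans (cong half (l₁ u₂ u₃)) (half-even _)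
    l₃ : ∀ a b c → + 2 * ((+ 1 + a + c) + (+ 1 + b + c) + - (+ 1 + b + c)) - (+ 1 + + 2 * c) ≡ + 1 + + 2 * a
    l₃ = solve-∀
    l₄ : ∀ a b c → - (+ 2 * - (+ 1 + b + c)) - (+ 1 + + 2 * c) ≡ + 1 + + 2 * b
    l₄ = solve-∀

  thetaProd-slices : thetaProdCoef a b N m
    ≡ Σbox N (λ r → Σbox N (λ s → when (linearForm a b r s) m (Σbox N (thetaSlice s (residual N r s)))))
  thetaProd-slices = begin
    Σ³ N thetaTerm
      ≡⟨ reindex thetaTerm (thetaTerm ∘ substitute) unsubstitute substitute thetaTerm-support substituted-support
                 (λ x nz → substitute-unsubstitute x nz , cong thetaTerm (substitute-unsubstitute x nz))
                 (λ y _ → unsubstitute-substitute y , refl) ⟩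
    Σ³ N (thetaTerm ∘ substitute)
      ≡⟨ Σ³-cong N (λ { (t , r , s) → thetaTerm-substitute t r s }) ⟩
    Σbox N (λ t → Σbox N (λ r → Σbox N (λ s → H t r s)))
      ≡⟨ ΣL-swap (box N) (box N) (λ t r → Σbox N (H t r)) ⟩
    Σbox N (λ r → Σbox N (λ t → Σbox N (λ s → H t r s)))
      ≡⟨ Σbox-cong N (λ r → ΣL-swap (box N) (box N) (λ t s → H t r s)) ⟩
    Σbox N (λ r → Σbox N (λ s → Σbox N (λ t → H t r s)))
      ≡⟨ Σbox-cong N (λ r → Σbox-cong N (λ s → ΣL-when (box N) (linearForm a b r s) m (thetaSlice s (residual N r s)))) ⟩
    Σbox N (λ r → Σbox N (λ s → when (linearForm a b r s) m (Σbox N (thetaSlice s (residual N r s))))) ∎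
    where
    open ≡-Reasoning
    open Reindex (cubeSum N) (cubeSum N) (Σ³-swap N)
    H : ℤ → ℤ → ℤ → ℤ
    H t r s = when (linearForm a b r s) m (thetaSlice s (residual N r s) t)

convolution-delta : ∀ N y Y c d → 0ℤ ℤ.≤ Y →
  sumN (suc N) (λ k → when (sq y) (+ k) c * when Y (+ (N ∸ k)) d) ≡ when (sq y + Y) (+ N) (c * d)
convolution-delta N y Y c d 0≤Y = begin
  sumN (suc N) (λ k → when (sq y) (+ k) c * when Y (+ (N ∸ k)) d)
    ≡⟨ sumN-cong (suc N) (λ k _ → trans (when-*ʳ (sq y) (+ k) c _) (cong (λ u → when u (+ k) (g k)) (sq-abs y))) ⟩
  sumN (suc N) (λ k → when (+ e) (+ k) (g k))
    ≡⟨ collapse (e ℕ.<? suc N) ⟩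
  when (+ e + Y) (+ N) (c * d)
    ≡⟨ cong (λ u → when (u + Y) (+ N) (c * d)) (sym (sq-abs y)) ⟩
  when (sq y + Y) (+ N) (c * d) ∎
  where
  open ≡-Reasoning
  e = ∣ y ∣ ℕ.* ∣ y ∣
  g : ℕ → ℤ
  g k = c * when Y (+ (N ∸ k)) d
  collapse : Dec (e ℕ.< suc N) → sumN (suc N) (λ k → when (+ e) (+ k) (g k)) ≡ when (+ e + Y) (+ N) (c * d)
  collapse (yes e<1+N) = begin
    sumN (suc N) (λ k → when (+ e) (+ k) (g k))   ≡⟨ sumN-delta-in (suc N) e g e<1+N ⟩
    c * when Y (+ (N ∸ e)) d                       ≡⟨ when-*ˡ Y (+ (N ∸ e)) d c ⟩
    when Y (+ (N ∸ e)) (c * d)                     ≡⟨ cong (λ u → when Y u (c * d)) (sym (sub-above N e (ℕP.≤-pred e<1+N))) ⟩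
    when Y (+ N - + e) (c * d)                     ≡⟨ sym (when-shift Y (+ e) (+ N) (c * d)) ⟩
    when (Y + + e) (+ N) (c * d)                   ≡⟨ cong (λ u → when u (+ N) (c * d)) (ℤP.+-comm Y (+ e)) ⟩
    when (+ e + Y) (+ N) (c * d)                   ∎
  collapse (no e≮1+N) =
    trans (sumN-delta-out (suc N) e g (ℕP.≮⇒≥ e≮1+N))
          (sym (when-no (c * d) (λ sum≡N → e≮1+N (s≤s (ℕP.≤-trans (ℕP.m≤m+n e ∣ Y ∣)
             (ℕP.≤-reflexive (ℤP.+-injective (trans (ℤP.pos-+ e ∣ Y ∣) (trans (cong (_+_ (+ e)) (ℤP.0≤i⇒+∣i∣≡i 0≤Y)) sum≡N)))))))))

module EtaSeries (a b : ℤ) (N : ℕ) (m : ℤ) where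

  seriesTerm : ℕ → ℤ → ℤ → ℤ
  seriesTerm M r s = when (+ 8 * Q r s) (+ M) (when (linearForm a b r s) m (leg3 s))

  seriesCoef-widen : ∀ M → M ≤ N → seriesCoef a b M m ≡ Σbox N (λ r → Σbox N (seriesTerm M r))
  seriesCoef-widen M M≤N =
    trans (Σbox-cong M (λ r → sym (Σbox-widen M N (seriesTerm M r) M≤N (λ s M<s → outside {r} {s} {s} M<s (proj₂ ∘ Q-bound r s M)))))
          (sym (Σbox-widen M N (λ r → Σbox N (seriesTerm M r)) M≤N
                 (λ r M<r → ΣL-vanish (box N) (seriesTerm M r) (λ s → outside {r} {s} {r} M<r (proj₁ ∘ Q-bound r s M)))))
    where
    outside : ∀ {r s x} → M ℕ.< ∣ x ∣ → (+ 8 * Q r s ≡ + M → ∣ x ∣ ≤ M) → seriesTerm M r s ≡ 0ℤ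
    outside M<x bound = when-no _ (λ e → ℕP.<⇒≱ M<x (bound e))

  etaTerm : ℕ → ℤ → ℤ
  etaTerm k j = when (sq (+ 1 + + 6 * j)) (+ k) (χ₋₄ (+ 1 + + 6 * j))

  product-term : ∀ k → k ≤ N →
    etaCoef k * seriesCoef a b (N ∸ k) m ≡ Σbox N (λ j → Σbox N (λ r → Σbox N (λ s → etaTerm k j * seriesTerm (N ∸ k) r s)))
  product-term k k≤N =
    trans (cong₂ _*_ (etaCoef-pentagonal N k k≤N) (seriesCoef-widen (N ∸ k) (ℕP.m∸n≤m N k)))
      (trans (sym (ΣL-*ʳ (box N) _ (etaTerm k)))
        (Σbox-cong N (λ j → trans (sym (ΣL-*ˡ (box N) (etaTerm k j) _))
                                  (Σbox-cong N (λ r → sym (ΣL-*ˡ (box N) (etaTerm k j) (seriesTerm (N ∸ k) r)))))))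

  product-collapse : ∀ j r s →
    sumN (suc N) (λ k → etaTerm k j * seriesTerm (N ∸ k) r s)
      ≡ when (linearForm a b r s) m (etaSlice s (residual N r s) j)
  product-collapse j r s = begin
    sumN (suc N) (λ k → etaTerm k j * seriesTerm (N ∸ k) r s)
      ≡⟨ convolution-delta N (+ 1 + + 6 * j) (+ 8 * Q r s) (χ₋₄ (+ 1 + + 6 * j)) (when L m (leg3 s)) (Q-nonneg r s) ⟩
    when (E + + 8 * Q r s) (+ N) (χ₋₄ (+ 1 + + 6 * j) * when L m (leg3 s))
      ≡⟨ cong (when (E + + 8 * Q r s) (+ N)) (when-*ˡ L m (leg3 s) (χ₋₄ (+ 1 + + 6 * j))) ⟩
    when (E + + 8 * Q r s) (+ N) (when L m (χ₋₄ (+ 1 + + 6 * j) * leg3 s))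
      ≡⟨ when-comm (E + + 8 * Q r s) (+ N) L m (χ₋₄ (+ 1 + + 6 * j) * leg3 s) ⟩
    when L m (when (E + + 8 * Q r s) (+ N) (χ₋₄ (+ 1 + + 6 * j) * leg3 s))
      ≡⟨ cong (when L m) (when-shift E (+ 8 * Q r s) (+ N) (χ₋₄ (+ 1 + + 6 * j) * leg3 s)) ⟩
    when L m (etaSlice s (residual N r s) j) ∎
    where
    open ≡-Reasoning
    E = sq (+ 1 + + 6 * j)
    L = linearForm a b r s

  rhs-slices : rhsCoef a b N m ≡ Σbox N (λ r → Σbox N (λ s → when (linearForm a b r s) m (- Σbox N (etaSlice s (residual N r s)))))
  rhs-slices = begin
    rhsCoef a b N m
      ≡⟨ cong -_ (Σupto-sumN N (λ k → etaCoef k * seriesCoef a b (N ∸ k) m)) ⟩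
    - sumN (suc N) (λ k → etaCoef k * seriesCoef a b (N ∸ k) m)
      ≡⟨ cong -_ (sumN-cong (suc N) (λ k k<1+N → product-term k (ℕP.≤-pred k<1+N))) ⟩
    - sumN (suc N) (λ k → Σbox N (λ j → Σbox N (λ r → Σbox N (λ s → P k j r s))))
      ≡⟨ cong -_ (trans (sumN-ΣL (suc N) (box N) (λ k j → Σbox N (λ r → Σbox N (P k j r))))
           (Σbox-cong N (λ j → trans (sumN-ΣL (suc N) (box N) (λ k r → Σbox N (P k j r)))
              (Σbox-cong N (λ r → trans (sumN-ΣL (suc N) (box N) (λ k → P k j r))
                 (Σbox-cong N (λ s → product-collapse j r s))))))) ⟩
    - Σbox N (λ j → Σbox N (λ r → Σbox N (λ s → when (linearForm a b r s) m (G r s j))))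
      ≡⟨ cong -_ (trans (ΣL-swap (box N) (box N) (λ j r → Σbox N (λ s → when (linearForm a b r s) m (G r s j))))
           (Σbox-cong N (λ r → trans (ΣL-swap (box N) (box N) (λ j s → when (linearForm a b r s) m (G r s j)))
              (Σbox-cong N (λ s → ΣL-when (box N) (linearForm a b r s) m (G r s)))))) ⟩
    - Σbox N (λ r → Σbox N (λ s → when (linearForm a b r s) m (Σbox N (G r s))))
      ≡⟨ sym (trans (Σbox-cong N (λ r → trans (Σbox-cong N (λ s → sym (when-neg (linearForm a b r s) m (Σbox N (G r s)))))
                                               (ΣL-neg (box N) (λ s → when (linearForm a b r s) m (Σbox N (G r s))))))
                    (ΣL-neg (box N) (λ r → Σbox N (λ s → when (linearForm a b r s) m (Σbox N (G r s)))))) ⟩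
    Σbox N (λ r → Σbox N (λ s → when (linearForm a b r s) m (- Σbox N (G r s)))) ∎
    where
    open ≡-Reasoning
    P : ℕ → ℤ → ℤ → ℤ → ℤ
    P k j r s = etaTerm k j * seriesTerm (N ∸ k) r s
    G : ℤ → ℤ → ℤ → ℤ
    G r s = etaSlice s (residual N r s)

theorem6p3 : (a b : ℕ) → 1 ≤ a → 1 ≤ b →
    (N : ℕ) (m : ℤ) → thetaProdCoef (+ a) (+ b) N m ≡ rhsCoef (+ a) (+ b) N m
theorem6p3 a b _ _ N m = begin
  thetaProdCoef (+ a) (+ b) N m
    ≡⟨ ThetaProduct.thetaProd-slices (+ a) (+ b) N m ⟩
  Σbox N (λ r → Σbox N (λ s → when (linearForm (+ a) (+ b) r s) m (Σbox N (thetaSlice s (residual N r s)))))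
    ≡⟨ Σbox-cong N (λ r → Σbox-cong-in N (λ s s≤N →
         cong (when (linearForm (+ a) (+ b) r s) m) (slice-identity N s (residual N r s) s≤N (residual-bound N r s)))) ⟩
  Σbox N (λ r → Σbox N (λ s → when (linearForm (+ a) (+ b) r s) m (- Σbox N (etaSlice s (residual N r s)))))
    ≡⟨ sym (EtaSeries.rhs-slices (+ a) (+ b) N m) ⟩
  rhsCoef (+ a) (+ b) N m ∎
  where
  open ≡-Reasoning
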